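{- Let $T$ be a free tree with vertex set $V$, and let $V^*=\{v\in V : D^{\mathrm{pl}}_{\max}(T)=D^{\mathrm{pr}}_{\max}(T^v)\}$. Then every vertex $v\in V^*$ is either a leaf of $T$ or an internal vertex of $T$ adjacent to at least one leaf.
   Context: A linear arrangement of a graph $G=(V,E)$ with $n=|V|$ is a bijection $\pi:V\to\{1,\dots,n\}$; the cost of $\pi$ is $\sum_{uv\in E}|\pi(u)-\pi(v)|$. Two edges $st,uv$ with $\pi(s)<\pi(t)$, $\pi(u)<\pi(v)$, $\pi(s)<\pi(u)$ cross if $\pi(s)<\pi(u)<\pi(t)<\pi(v)$; an arrangement is planar if no two edges cross. $D^{\mathrm{pl}}_{\max}(T)$ is the maximum cost over all planar arrangements of $T$. For $v\in V$, $T^v$ denotes $T$ rooted at $v$; an arrangement of $T^v$ is projective if it is planar and no edge $xy$ satisfies $\min(\pi(x),\pi(y))<\pi(v)<\max(\pi(x),\pi(y))$, and $D^{\mathrm{pr}}_{\max}(T^v)$ is the maximum cost over projective arrangements of $T^v$. -}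

module Defs where

open import Data.Nat using (ℕ; suc; _+_; _<_; _≤_; _⊓_; _⊔_; ∣_-_∣)
open import Data.Fin using (Fin; toℕ; _≟_)
open import Data.Fin.Permutation using (Permutation′; _⟨$⟩ʳ_)
open import Data.Product using (_×_; _,_; Σ; ∃; ∃-syntax)
open import Data.Sum using (_⊎_)
open import Data.List using (List; map; length; filter)
open import Data.Nat.ListAction using (sum)
open import Data.List.Membership.Propositional using (_∈_)
open import Relation.Nullary using (¬_)
open import Relation.Nullary.Decidable using (_⊎-dec_)
open import Relation.Binary.PropositionalEquality using (_≡_)
open import Relation.Binary.Construct.Closure.ReflexiveTransitive using (Star)

-- A graph on vertex set Fin n, given by its list of edges (each edge an
-- unordered pair, stored as an ordered pair of endpoints).
Edges : ℕ → Set
Edges n = List (Fin n × Fin n)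

Adj : ∀ {n} → Edges n → Fin n → Fin n → Set
Adj E u v = ((u , v) ∈ E) ⊎ ((v , u) ∈ E)

degree : ∀ {n} → Edges n → Fin n → ℕ
degree E v = length (filter (λ e → (Data.Product.proj₁ e ≟ v) ⊎-dec (Data.Product.proj₂ e ≟ v)) E)

Leaf : ∀ {n} → Edges n → Fin n → Set
Leaf E v = degree E v ≡ 1

Connected : ∀ {n} → Edges n → Set
Connected E = ∀ u v → Star (Adj E) u v

-- No loops and no parallel edges
Simple : ∀ {n} → Edges n → Set
Simple {n} E = (∀ (u : Fin n) → ¬ ((u , u) ∈ E))
  × (∀ xs ys (u v : Fin n) → E ≡ Data.List._++_ xs ys → (u , v) ∈ xs → ¬ Adj ys u v)

IsTree : (n : ℕ) → Edges n → Set
IsTree n E = Simple E × Connected E × (suc (length E) ≡ n)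

-- Linear arrangements: bijections V → positions (positions 0..n-1
-- instead of 1..n; only differences and order matter).
Arrangement : ℕ → Set
Arrangement n = Permutation′ n

pos : ∀ {n} → Arrangement n → Fin n → ℕ
pos π u = toℕ (π ⟨$⟩ʳ u)

cost : ∀ {n} → Edges n → Arrangement n → ℕ
cost E π = sum (map (λ e → ∣ pos π (Data.Product.proj₁ e) - pos π (Data.Product.proj₂ e) ∣) E)

lo hi : ∀ {n} → Arrangement n → Fin n × Fin n → ℕ
lo π (u , v) = pos π u ⊓ pos π v
hi π (u , v) = pos π u ⊔ pos π v

Cross : ∀ {n} → Arrangement n → (e f : Fin n × Fin n) → Set
Cross π e f = (lo π e < lo π f × lo π f < hi π e × hi π e < hi π f)
            ⊎ (lo π f < lo π e × lo π e < hi π f × hi π f < hi π e)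

Planar : ∀ {n} → Edges n → Arrangement n → Set
Planar E π = ∀ e f → e ∈ E → f ∈ E → ¬ Cross π e f

Projective : ∀ {n} → Edges n → Fin n → Arrangement n → Set
Projective E r π = Planar E π × (∀ e → e ∈ E → ¬ (lo π e < pos π r × pos π r < hi π e))

IsDplMax : ∀ {n} → Edges n → ℕ → Set
IsDplMax E m = (Σ _ λ π → Planar E π × cost E π ≡ m)
             × (∀ π → Planar E π → cost E π ≤ m)

IsDprMax : ∀ {n} → Edges n → Fin n → ℕ → Set
IsDprMax E r m = (Σ _ λ π → Projective E r π × cost E π ≡ m)
               × (∀ π → Projective E r π → cost E π ≤ m)

InVStar : ∀ {n} → Edges n → Fin n → Set
InVStar E v = ∃[ m ] (IsDplMax E m × IsDprMax E v m)

-- A projective arrangement of T rooted at v whose cost is the planar maximum is in particular a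
-- maximum planar arrangement. Reversing a block of positions that is attached to the rest only through
-- its first position keeps an arrangement planar and stretches the attaching edges, so a maximum planar
-- arrangement has no such block. Projectivity makes the block starting at the root such a block, so v is
-- at an end, say first; then the farthest neighbour u of v must be last. Suppose neither v nor u is a
-- leaf, and take the last neighbour w of v before u and the first neighbour z of u after v. Either the
-- edges vw and uz cross; or every cut between w and z is spanned by an edge other than vu, and these
-- edges lead from w to z, closing a cycle with vu; or some cut between them is spanned by vu alone, and
-- exchanging the two blocks on either side of that cut (after reflecting the arrangement if necessary)
-- lengthens vw or uz by more than it shortens vu.

module Submission where

open import Defs
open import Data.Nat
open import Data.Nat.Properties
open import Data.Nat.ListAction using (sum)
open import Data.Fin using (Fin; toℕ; fromℕ<) renaming (_≟_ to _≟ᶠ_)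
open import Data.Fin.Properties as Finₚ using (toℕ<n; toℕ-injective; toℕ-fromℕ<)
open import Data.Fin.Permutation using (permutation; _⟨$⟩ʳ_; _⟨$⟩ˡ_; _∘ₚ_; inverseʳ; inverseˡ)
open import Data.Product using (_×_; _,_; proj₁; proj₂; ∃; ∃-syntax)
open import Data.Product.Properties using (≡-dec)
open import Data.Sum using (_⊎_; inj₁; inj₂; [_,_]′; swap)
open import Data.Empty using (⊥; ⊥-elim)
open import Data.Bool using (true; false; if_then_else_)
open import Function using (_∘_; id)
open import Algebra.Properties.CommutativeSemigroup +-commutativeSemigroup using (interchange)
open import Data.List using (List; []; _∷_; _++_; length; map; filter; allFin)
open import Data.List.Properties using (map-cong; length-tabulate; length-removeAt′; filter-none; filter-some; filter-notAll)
open import Data.List.Membership.Propositional as Mem using (_∈_; _∉_)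
open import Data.List.Membership.Propositional.Properties using (∈-filter⁺; ∈-allFin)
open import Data.List.Membership.DecPropositional using () renaming (_∈?_ to ∈-dec)
open import Data.List.Relation.Unary.Any as Any using (here; there; _─_)
open import Data.List.Relation.Unary.All as All using (All; []; _∷_; all?)
open import Data.List.Relation.Unary.All.Properties using (all-filter; ¬All⇒Any¬; ¬Any⇒All¬)
open import Data.List.Relation.Unary.AllPairs using (AllPairs; []; _∷_)
open import Data.List.Relation.Unary.Unique.Propositional using (Unique)
open import Data.List.Relation.Unary.Unique.Propositional.Properties using (allFin⁺)
open import Data.List.Extrema.Nat using (argmax; argmin; argmax-all; argmin-all; f[xs]≤f[argmax]; f[argmin]≤f[xs])
open import Relation.Nullary using (¬_; Dec; yes; no; does)
open import Relation.Nullary.Decidable using (_⊎-dec_; _×-dec_; _→-dec_; ¬?)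
open import Relation.Unary using (Decidable)
open import Relation.Binary.PropositionalEquality
open import Relation.Binary.Definitions using (tri<; tri≈; tri>)
open import Relation.Binary.Construct.Closure.ReflexiveTransitive using (Star; ε; _◅_; _◅◅_; reverse; _>>=_)

-- Crossing intervals

Interleaved : ℕ → ℕ → ℕ → ℕ → Set
Interleaved l₁ h₁ l₂ h₂ = (l₁ < l₂ × l₂ < h₁ × h₁ < h₂) ⊎ (l₂ < l₁ × l₁ < h₂ × h₂ < h₁)

Crosses : ℕ → ℕ → ℕ → ℕ → Set
Crosses a b c d = Interleaved (a ⊓ b) (a ⊔ b) (c ⊓ d) (c ⊔ d)

Between : ℕ → ℕ → ℕ → Set
Between a b x = a ⊓ b < x × x < a ⊔ b

crosses-sym : ∀ {a b c d} → Crosses a b c d → Crosses c d a b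
crosses-sym = swap

crosses⇒between : ∀ {a b c d} → Crosses a b c d → Between a b c ⊎ Between a b d
crosses⇒between {c = c} {d} (inj₁ (lo< , lo<hi , _)) = one-of (⊓-sel c d) (lo< , lo<hi)
  where
  one-of : ∀ {m} → m ≡ c ⊎ m ≡ d → Between _ _ m → Between _ _ c ⊎ Between _ _ d
  one-of (inj₁ refl) between = inj₁ between
  one-of (inj₂ refl) between = inj₂ between
crosses⇒between {c = c} {d} (inj₂ (_ , lo<hi , hi<)) = one-of (⊔-sel c d) (lo<hi , hi<)
  where
  one-of : ∀ {m} → m ≡ c ⊎ m ≡ d → Between _ _ m → Between _ _ c ⊎ Between _ _ d
  one-of (inj₁ refl) between = inj₁ between
  one-of (inj₂ refl) between = inj₂ between

separated⇒¬crosses : ∀ {a b c d} → ¬ Between a b c → ¬ Between a b d → ¬ Crosses a b c d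
separated⇒¬crosses ¬c ¬d cr = [ ¬c , ¬d ]′ (crosses⇒between cr)

module _ (S : ℕ → Set) where
  ⊓-closed : ∀ {x y} → S x → S y → S (x ⊓ y)
  ⊓-closed {x} {y} sx sy = [ (λ eq → subst S (sym eq) sx) , (λ eq → subst S (sym eq) sy) ]′ (⊓-sel x y)

  ⊔-closed : ∀ {x y} → S x → S y → S (x ⊔ y)
  ⊔-closed {x} {y} sx sy = [ (λ eq → subst S (sym eq) sx) , (λ eq → subst S (sym eq) sy) ]′ (⊔-sel x y)

module MonotoneOn (S : ℕ → Set) (h : ℕ → ℕ)
                  (mono : ∀ {x y} → S x → S y → x < y → h x < h y) where
  reflects-< : ∀ {x y} → S x → S y → h x < h y → x < y
  reflects-< {x} {y} sx sy hx<hy with <-cmp x y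
  ... | tri< x<y _ _ = x<y
  ... | tri≈ _ refl _ = ⊥-elim (<-irrefl refl hx<hy)
  ... | tri> _ _ y<x = ⊥-elim (<-asym hx<hy (mono sy sx y<x))

  preserves-≤ : ∀ {x y} → S x → S y → x ≤ y → h x ≤ h y
  preserves-≤ sx sy x≤y with m≤n⇒m<n∨m≡n x≤y
  ... | inj₁ x<y = <⇒≤ (mono sx sy x<y)
  ... | inj₂ refl = ≤-refl

  h-⊓ : ∀ {x y} → S x → S y → h (x ⊓ y) ≡ h x ⊓ h y
  h-⊓ {x} {y} sx sy with ≤-total x y
  ... | inj₁ x≤y = trans (cong h (m≤n⇒m⊓n≡m x≤y)) (sym (m≤n⇒m⊓n≡m (preserves-≤ sx sy x≤y)))
  ... | inj₂ y≤x = trans (cong h (m≥n⇒m⊓n≡n y≤x)) (sym (m≥n⇒m⊓n≡n (preserves-≤ sy sx y≤x)))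

  h-⊔ : ∀ {x y} → S x → S y → h (x ⊔ y) ≡ h x ⊔ h y
  h-⊔ {x} {y} sx sy with ≤-total x y
  ... | inj₁ x≤y = trans (cong h (m≤n⇒m⊔n≡n x≤y)) (sym (m≤n⇒m⊔n≡n (preserves-≤ sx sy x≤y)))
  ... | inj₂ y≤x = trans (cong h (m≥n⇒m⊔n≡m y≤x)) (sym (m≥n⇒m⊔n≡m (preserves-≤ sy sx y≤x)))

  reflects-interleaved : ∀ {l₁ h₁ l₂ h₂} → S l₁ → S h₁ → S l₂ → S h₂ →
                         Interleaved (h l₁) (h h₁) (h l₂) (h h₂) → Interleaved l₁ h₁ l₂ h₂
  reflects-interleaved s₁ t₁ s₂ t₂ =
    Data.Sum.map (λ (p , q , r) → reflects-< s₁ s₂ p , reflects-< s₂ t₁ q , reflects-< t₁ t₂ r)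
                 (λ (p , q , r) → reflects-< s₂ s₁ p , reflects-< s₁ t₂ q , reflects-< t₂ t₁ r)

  reflects-crosses : ∀ {a b c d} → S a → S b → S c → S d →
                     Crosses (h a) (h b) (h c) (h d) → Crosses a b c d
  reflects-crosses sa sb sc sd cr =
    reflects-interleaved (⊓-closed S sa sb) (⊔-closed S sa sb) (⊓-closed S sc sd) (⊔-closed S sc sd)
      (subst₂ (λ l₁ h₁ → Interleaved l₁ h₁ _ _) (sym (h-⊓ sa sb)) (sym (h-⊔ sa sb))
        (subst₂ (Interleaved _ _) (sym (h-⊓ sc sd)) (sym (h-⊔ sc sd)) cr))

module AntitoneOn (S : ℕ → Set) (h : ℕ → ℕ)
                  (anti : ∀ {x y} → S x → S y → x < y → h y < h x) where
  reflects-< : ∀ {x y} → S x → S y → h x < h y → y < x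
  reflects-< {x} {y} sx sy hx<hy with <-cmp x y
  ... | tri< x<y _ _ = ⊥-elim (<-asym hx<hy (anti sx sy x<y))
  ... | tri≈ _ refl _ = ⊥-elim (<-irrefl refl hx<hy)
  ... | tri> _ _ y<x = y<x

  reverses-≤ : ∀ {x y} → S x → S y → x ≤ y → h y ≤ h x
  reverses-≤ sx sy x≤y with m≤n⇒m<n∨m≡n x≤y
  ... | inj₁ x<y = <⇒≤ (anti sx sy x<y)
  ... | inj₂ refl = ≤-refl

  h-⊓ : ∀ {x y} → S x → S y → h (x ⊓ y) ≡ h x ⊔ h y
  h-⊓ {x} {y} sx sy with ≤-total x y
  ... | inj₁ x≤y = trans (cong h (m≤n⇒m⊓n≡m x≤y)) (sym (m≥n⇒m⊔n≡m (reverses-≤ sx sy x≤y)))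
  ... | inj₂ y≤x = trans (cong h (m≥n⇒m⊓n≡n y≤x)) (sym (m≤n⇒m⊔n≡n (reverses-≤ sy sx y≤x)))

  h-⊔ : ∀ {x y} → S x → S y → h (x ⊔ y) ≡ h x ⊓ h y
  h-⊔ {x} {y} sx sy with ≤-total x y
  ... | inj₁ x≤y = trans (cong h (m≤n⇒m⊔n≡n x≤y)) (sym (m≥n⇒m⊓n≡n (reverses-≤ sx sy x≤y)))
  ... | inj₂ y≤x = trans (cong h (m≥n⇒m⊔n≡m y≤x)) (sym (m≤n⇒m⊓n≡m (reverses-≤ sy sx y≤x)))

  reflects-interleaved : ∀ {l₁ h₁ l₂ h₂} → S l₁ → S h₁ → S l₂ → S h₂ →
                         Interleaved (h h₁) (h l₁) (h h₂) (h l₂) → Interleaved l₁ h₁ l₂ h₂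
  reflects-interleaved s₁ t₁ s₂ t₂ =
    swap ∘ Data.Sum.map (λ (p , q , r) → reflects-< s₁ s₂ r , reflects-< t₂ s₁ q , reflects-< t₁ t₂ p)
                        (λ (p , q , r) → reflects-< s₂ s₁ r , reflects-< t₁ s₂ q , reflects-< t₂ t₁ p)

  reflects-crosses : ∀ {a b c d} → S a → S b → S c → S d →
                     Crosses (h a) (h b) (h c) (h d) → Crosses a b c d
  reflects-crosses sa sb sc sd cr =
    reflects-interleaved (⊓-closed S sa sb) (⊔-closed S sa sb) (⊓-closed S sc sd) (⊔-closed S sc sd)
      (subst₂ (λ h₁ l₁ → Interleaved h₁ l₁ _ _) (sym (h-⊔ sa sb)) (sym (h-⊓ sa sb))
        (subst₂ (Interleaved _ _) (sym (h-⊔ sc sd)) (sym (h-⊓ sc sd)) cr))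

-- Rearranging positions

∣-∣-reflect : ∀ {K x y} → x ≤ K → y ≤ K → ∣ (K ∸ x) - (K ∸ y) ∣ ≡ ∣ x - y ∣
∣-∣-reflect {K} {x} {y} x≤K y≤K =
  [ (λ x≤y → ordered x≤y y≤K)
  , (λ y≤x → trans (∣-∣-comm (K ∸ x) (K ∸ y)) (trans (ordered y≤x x≤K) (∣-∣-comm y x))) ]′ (≤-total x y)
  where
  open ≡-Reasoning
  ordered : ∀ {x y} → x ≤ y → y ≤ K → ∣ (K ∸ x) - (K ∸ y) ∣ ≡ ∣ x - y ∣
  ordered {x} {y} x≤y y≤K = begin
    ∣ (K ∸ x) - (K ∸ y) ∣       ≡⟨ m≤n⇒∣n-m∣≡n∸m (∸-monoʳ-≤ K x≤y) ⟩
    (K ∸ x) ∸ (K ∸ y)           ≡⟨ cong (λ m → m ∸ x ∸ (K ∸ y)) (m∸n+n≡m y≤K) ⟨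
    (K ∸ y) + y ∸ x ∸ (K ∸ y)   ≡⟨ cong (_∸ (K ∸ y)) (+-∸-assoc (K ∸ y) x≤y) ⟩
    (K ∸ y) + (y ∸ x) ∸ (K ∸ y) ≡⟨ m+n∸m≡n (K ∸ y) (y ∸ x) ⟩
    y ∸ x                       ≡⟨ m≤n⇒∣m-n∣≡n∸m x≤y ⟨
    ∣ x - y ∣                   ∎

∣-∣-∸ : ∀ {c x y} → c ≤ x → c ≤ y → ∣ (x ∸ c) - (y ∸ c) ∣ ≡ ∣ x - y ∣
∣-∣-∸ {c} {x} {y} c≤x c≤y = begin
  ∣ (x ∸ c) - (y ∸ c) ∣         ≡⟨ ∣m+n-m+o∣≡∣n-o∣ c (x ∸ c) (y ∸ c) ⟨
  ∣ c + (x ∸ c) - c + (y ∸ c) ∣ ≡⟨ cong₂ ∣_-_∣ (m+[n∸m]≡n c≤x) (m+[n∸m]≡n c≤y) ⟩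
  ∣ x - y ∣                     ∎
  where open ≡-Reasoning

-- The edge between positions a and b passes over the gap just before position k.
Spans : ℕ → ℕ → ℕ → Set
Spans k a b = a ⊓ b < k × k ≤ a ⊔ b

spans-sym : ∀ {k a b} → Spans k a b → Spans k b a
spans-sym {k} {a} {b} (lo<k , k≤hi) = subst (_< k) (⊓-comm a b) lo<k , subst (k ≤_) (⊔-comm a b) k≤hi

record PositionBijection (n : ℕ) : Set where
  field
    to from : ℕ → ℕ
    to-< : ∀ {x} → x < n → to x < n
    from-< : ∀ {x} → x < n → from x < n
    from-to : ∀ {x} → x < n → from (to x) ≡ x
    to-from : ∀ {x} → x < n → to (from x) ≡ x

involution : ∀ {N} (f : ℕ → ℕ) → (∀ {x} → x ≤ N → f x ≤ N) → (∀ {x} → x ≤ N → f (f x) ≡ x) →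
             PositionBijection (suc N)
involution f f≤N ff≡id = record
  { to = f ; from = f
  ; to-< = λ x<n → s≤s (f≤N (s≤s⁻¹ x<n)) ; from-< = λ x<n → s≤s (f≤N (s≤s⁻¹ x<n))
  ; from-to = λ x<n → ff≡id (s≤s⁻¹ x<n) ; to-from = λ x<n → ff≡id (s≤s⁻¹ x<n) }

module _ {n : ℕ} (σ : PositionBijection n) where
  open PositionBijection σ

  rearrange : Arrangement n → Arrangement n
  rearrange π = π ∘ₚ permutation to′ from′ to′-from′ from′-to′
    where
    to′ from′ : Fin n → Fin n
    to′ i = fromℕ< (to-< (toℕ<n i))
    from′ i = fromℕ< (from-< (toℕ<n i))
    to′-from′ : ∀ i → to′ (from′ i) ≡ i
    to′-from′ i = toℕ-injective (trans (toℕ-fromℕ< _) (trans (cong to (toℕ-fromℕ< _)) (to-from (toℕ<n i))))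
    from′-to′ : ∀ i → from′ (to′ i) ≡ i
    from′-to′ i = toℕ-injective (trans (toℕ-fromℕ< _) (trans (cong from (toℕ-fromℕ< _)) (from-to (toℕ<n i))))

  pos-rearrange : ∀ π x → pos (rearrange π) x ≡ to (pos π x)
  pos-rearrange π x = toℕ-fromℕ< _

module Reflection (N : ℕ) where
  f : ℕ → ℕ
  f x = N ∸ x

  f-involutive : ∀ {x} → x ≤ N → f (f x) ≡ x
  f-involutive = m∸[m∸n]≡n

  σ : PositionBijection (suc N)
  σ = involution f (λ {x} _ → m∸n≤m N x) f-involutive

  decreasing : ∀ {x y} → x ≤ N → y ≤ N → x < y → f y < f x
  decreasing _ y≤N x<y = ∸-monoʳ-< x<y y≤N

  open AntitoneOn (_≤ N) f decreasing public using (reflects-crosses; h-⊓; h-⊔)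

module SuffixReversal (N q : ℕ) (q≤N : q ≤ N) where
  f : ℕ → ℕ
  f x with x <? q
  ... | yes _ = x
  ... | no _ = N + q ∸ x

  f-below : ∀ {x} → x < q → f x ≡ x
  f-below {x} x<q with x <? q
  ... | yes _ = refl
  ... | no x≮q = ⊥-elim (x≮q x<q)

  f-above : ∀ {x} → q ≤ x → f x ≡ N + q ∸ x
  f-above {x} q≤x with x <? q
  ... | yes x<q = ⊥-elim (<⇒≱ x<q q≤x)
  ... | no _ = refl

  f-q : f q ≡ N
  f-q = trans (f-above ≤-refl) (m+n∸n≡m N q)

  q≤mirror : ∀ {x} → x ≤ N → q ≤ N + q ∸ x
  q≤mirror {x} x≤N = subst (_≤ N + q ∸ x) (m+n∸m≡n N q) (∸-monoʳ-≤ (N + q) x≤N)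

  mirror≤N : ∀ {x} → q ≤ x → N + q ∸ x ≤ N
  mirror≤N {x} q≤x = subst (N + q ∸ x ≤_) (m+n∸n≡m N q) (∸-monoʳ-≤ (N + q) q≤x)

  f-≤N : ∀ {x} → x ≤ N → f x ≤ N
  f-≤N {x} x≤N with x <? q
  ... | yes _ = x≤N
  ... | no x≮q = mirror≤N (≮⇒≥ x≮q)

  f-involutive : ∀ {x} → x ≤ N → f (f x) ≡ x
  f-involutive {x} x≤N with x <? q
  ... | yes x<q = f-below x<q
  ... | no x≮q = trans (f-above (q≤mirror x≤N)) (m∸[m∸n]≡n (≤-trans x≤N (m≤m+n N q)))

  σ : PositionBijection (suc N)
  σ = involution f f-≤N f-involutive

  Hinged : ℕ → ℕ → Set
  Hinged a b = Spans q a b → a ⊔ b ≡ q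

  hinged-sym : ∀ {a b} → Hinged a b → Hinged b a
  hinged-sym {a} {b} h sp = trans (⊔-comm b a) (h (spans-sym sp))

  hinged-at-q : ∀ {a b} → a < q → q ≤ b → Hinged a b → b ≡ q
  hinged-at-q {a} {b} a<q q≤b h = ≤-antisym (subst (b ≤_) a⊔b≡q (m≤n⊔m a b)) q≤b
    where
    a⊔b≡q : a ⊔ b ≡ q
    a⊔b≡q = h (≤-<-trans (m⊓n≤m a b) a<q , ≤-trans q≤b (m≤n⊔m a b))

  hinge-lengths : ∀ {a} → a < q → ∣ a - q ∣ ≡ q ∸ a × ∣ f a - f q ∣ ≡ N ∸ a
  hinge-lengths a<q = m≤n⇒∣m-n∣≡n∸m (<⇒≤ a<q)
                    , trans (cong₂ ∣_-_∣ (f-below a<q) f-q) (m≤n⇒∣m-n∣≡n∸m (≤-trans (<⇒≤ a<q) q≤N))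

  hinge-stretches : ∀ {a} → a < q → ∣ a - q ∣ ≤ ∣ f a - f q ∣
  hinge-stretches {a} a<q with hinge-lengths a<q
  ... | old , new = subst₂ _≤_ (sym old) (sym new) (∸-monoˡ-≤ a q≤N)

  hinge-stretches-strictly : ∀ {a} → a < q → q < N → ∣ a - q ∣ < ∣ f a - f q ∣
  hinge-stretches-strictly {a} a<q q<N with hinge-lengths a<q
  ... | old , new = subst₂ _<_ (sym old) (sym new) (∸-monoˡ-< q<N (<⇒≤ a<q))

  length-≤ : ∀ {a b} → a ≤ N → b ≤ N → Hinged a b → ∣ a - b ∣ ≤ ∣ f a - f b ∣
  length-≤ {a} {b} a≤N b≤N h with q ≤? a | q ≤? b
  ... | no a≱q | no b≱q = ≤-reflexive (sym (cong₂ ∣_-_∣ (f-below (≰⇒> a≱q)) (f-below (≰⇒> b≱q))))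
  ... | yes q≤a | yes q≤b = ≤-reflexive (sym (begin
    ∣ f a - f b ∣                 ≡⟨ cong₂ ∣_-_∣ (f-above q≤a) (f-above q≤b) ⟩
    ∣ N + q ∸ a - (N + q ∸ b) ∣   ≡⟨ ∣-∣-reflect (≤-trans a≤N (m≤m+n N q)) (≤-trans b≤N (m≤m+n N q)) ⟩
    ∣ a - b ∣                     ∎))
    where open ≡-Reasoning
  ... | no a≱q | yes q≤b with hinged-at-q (≰⇒> a≱q) q≤b h
  ...   | refl = hinge-stretches (≰⇒> a≱q)
  length-≤ {a} {b} a≤N b≤N h | yes q≤a | no b≱q with hinged-at-q (≰⇒> b≱q) q≤a (hinged-sym h)
  ...   | refl = subst₂ _≤_ (∣-∣-comm b a) (∣-∣-comm (f b) (f a)) (hinge-stretches (≰⇒> b≱q))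

  length-< : ∀ {a b} → a ⊓ b < q → a ⊔ b ≡ q → q < N → ∣ a - b ∣ < ∣ f a - f b ∣
  length-< {a} {b} lo<q hi≡q q<N with ≤-total a b
  ... | inj₁ a≤b with trans (sym (m≤n⇒m⊔n≡n a≤b)) hi≡q
  ...   | refl = hinge-stretches-strictly (subst (_< b) (m≤n⇒m⊓n≡m a≤b) lo<q) q<N
  length-< {a} {b} lo<q hi≡q q<N | inj₂ b≤a with trans (sym (m≥n⇒m⊔n≡m b≤a)) hi≡q
  ...   | refl = subst₂ _<_ (∣-∣-comm b a) (∣-∣-comm (f b) (f a))
                   (hinge-stretches-strictly (subst (_< a) (m≥n⇒m⊓n≡n b≤a) lo<q) q<N)

  -- Position q lies in both blocks: f sends it to N, the far end of the reversed suffix.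
  Prefix Suffix : ℕ → Set
  Prefix x = x ≤ q
  Suffix x = q ≤ x × x ≤ N

  side : ∀ {a b} → a ≤ N → b ≤ N → Hinged a b → (Prefix a × Prefix b) ⊎ (Suffix a × Suffix b)
  side {a} {b} a≤N b≤N h with a <? q | b <? q
  ... | yes a<q | yes b<q = inj₁ (<⇒≤ a<q , <⇒≤ b<q)
  ... | no a≮q | no b≮q = inj₂ ((≮⇒≥ a≮q , a≤N) , (≮⇒≥ b≮q , b≤N))
  ... | yes a<q | no b≮q = inj₁ (<⇒≤ a<q , ≤-reflexive (hinged-at-q a<q (≮⇒≥ b≮q) h))
  ... | no a≮q | yes b<q = inj₁ (≤-reflexive (hinged-at-q b<q (≮⇒≥ a≮q) (hinged-sym h)) , <⇒≤ b<q)

  increasing-on-prefix : ∀ {x y} → Prefix x → Prefix y → x < y → f x < f y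
  increasing-on-prefix {x} {y} _ y≤q x<y with q ≤? y
  ... | no y≱q = subst₂ _<_ (sym (f-below (<-trans x<y (≰⇒> y≱q)))) (sym (f-below (≰⇒> y≱q))) x<y
  ... | yes q≤y = subst₂ _<_ (sym (f-below (<-≤-trans x<y y≤q))) (sym fy≡N) (<-≤-trans x<y (≤-trans y≤q q≤N))
    where
    fy≡N : f y ≡ N
    fy≡N = trans (cong f (≤-antisym y≤q q≤y)) f-q

  decreasing-on-suffix : ∀ {x y} → Suffix x → Suffix y → x < y → f y < f x
  decreasing-on-suffix (q≤x , _) (q≤y , y≤N) x<y rewrite f-above q≤x | f-above q≤y =
    ∸-monoʳ-< x<y (≤-trans y≤N (m≤m+n N q))

  f-suffix : ∀ {x} → Suffix x → Suffix (f x)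
  f-suffix (q≤x , x≤N) rewrite f-above q≤x = q≤mirror x≤N , mirror≤N q≤x

  f-prefix : ∀ {x} → Prefix x → f x < q ⊎ f x ≡ N
  f-prefix {x} x≤q with q ≤? x
  ... | no x≱q = inj₁ (subst (_< q) (sym (f-below (≰⇒> x≱q))) (≰⇒> x≱q))
  ... | yes q≤x = inj₂ (trans (cong f (≤-antisym x≤q q≤x)) f-q)

  prefix-outside-suffix : ∀ {x c d} → Prefix x → Suffix c → Suffix d → ¬ Between (f c) (f d) (f x)
  prefix-outside-suffix x≤q sc sd (lo< , <hi) with f-prefix x≤q | f-suffix sc | f-suffix sd
  ... | inj₁ fx<q | (q≤c , _) | (q≤d , _) = <⇒≱ (<-trans lo< fx<q) (⊓-glb q≤c q≤d)
  ... | inj₂ fx≡N | (_ , c≤N) | (_ , d≤N) = <⇒≱ (subst (_< _) fx≡N <hi) (⊔-lub c≤N d≤N)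

  reflects-crosses : ∀ {a b c d} → a ≤ N → b ≤ N → c ≤ N → d ≤ N → Hinged a b → Hinged c d →
                     Crosses (f a) (f b) (f c) (f d) → Crosses a b c d
  reflects-crosses a≤N b≤N c≤N d≤N hab hcd cr with side a≤N b≤N hab | side c≤N d≤N hcd
  ... | inj₁ (pa , pb) | inj₁ (pc , pd) = MonotoneOn.reflects-crosses Prefix f increasing-on-prefix pa pb pc pd cr
  ... | inj₂ (sa , sb) | inj₂ (sc , sd) = AntitoneOn.reflects-crosses Suffix f decreasing-on-suffix sa sb sc sd cr
  ... | inj₁ (pa , pb) | inj₂ (sc , sd) =
    ⊥-elim (separated⇒¬crosses (prefix-outside-suffix pa sc sd) (prefix-outside-suffix pb sc sd) (crosses-sym cr))
  ... | inj₂ (sa , sb) | inj₁ (pc , pd) =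
    ⊥-elim (separated⇒¬crosses (prefix-outside-suffix pc sa sb) (prefix-outside-suffix pd sa sb) cr)

-- f fixes position 0 and exchanges the blocks behind it: 0 | 1 … j | j+1 … N becomes 0 | r+1 … N | 1 … r.
module BlockSwap (N j r : ℕ) (j+r≡N : j + r ≡ N) where
  shift unshift : ℕ → ℕ
  shift y with y <? j
  ... | yes _ = y + r
  ... | no _ = y ∸ j
  unshift z with z <? r
  ... | yes _ = z + j
  ... | no _ = z ∸ r

  f g : ℕ → ℕ
  f zero = zero
  f (suc y) = suc (shift y)
  g zero = zero
  g (suc z) = suc (unshift z)

  shift-below : ∀ {y} → y < j → shift y ≡ y + r
  shift-below {y} y<j with y <? j
  ... | yes _ = refl
  ... | no y≮j = ⊥-elim (y≮j y<j)

  shift-above : ∀ {y} → j ≤ y → shift y ≡ y ∸ j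
  shift-above {y} j≤y with y <? j
  ... | yes y<j = ⊥-elim (<⇒≱ y<j j≤y)
  ... | no _ = refl

  unshift-below : ∀ {z} → z < r → unshift z ≡ z + j
  unshift-below {z} z<r with z <? r
  ... | yes _ = refl
  ... | no z≮r = ⊥-elim (z≮r z<r)

  unshift-above : ∀ {z} → r ≤ z → unshift z ≡ z ∸ r
  unshift-above {z} r≤z with z <? r
  ... | yes z<r = ⊥-elim (<⇒≱ z<r r≤z)
  ... | no _ = refl

  N∸j≡r : N ∸ j ≡ r
  N∸j≡r = trans (cong (_∸ j) (sym j+r≡N)) (m+n∸m≡n j r)

  N∸r≡j : N ∸ r ≡ j
  N∸r≡j = trans (cong (_∸ r) (sym j+r≡N)) (m+n∸n≡m j r)

  shift-< : ∀ {y} → y < N → shift y < N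
  shift-< {y} y<N with y <? j
  ... | yes y<j = subst (y + r <_) j+r≡N (+-monoˡ-< r y<j)
  ... | no _ = ≤-<-trans (m∸n≤m y j) y<N

  unshift-< : ∀ {z} → z < N → unshift z < N
  unshift-< {z} z<N with z <? r
  ... | yes z<r = subst (z + j <_) (trans (+-comm r j) j+r≡N) (+-monoˡ-< j z<r)
  ... | no _ = ≤-<-trans (m∸n≤m z r) z<N

  unshift-shift : ∀ {y} → y < N → unshift (shift y) ≡ y
  unshift-shift {y} y<N with y <? j
  ... | yes _ = trans (unshift-above (m≤n+m r y)) (m+n∸n≡m y r)
  ... | no y≮j = trans (unshift-below (subst (y ∸ j <_) N∸j≡r (∸-monoˡ-< y<N (≮⇒≥ y≮j))))
                       (m∸n+n≡m (≮⇒≥ y≮j))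

  shift-unshift : ∀ {z} → z < N → shift (unshift z) ≡ z
  shift-unshift {z} z<N with z <? r
  ... | yes _ = trans (shift-above (m≤n+m j z)) (m+n∸n≡m z j)
  ... | no z≮r = trans (shift-below (subst (z ∸ r <_) N∸r≡j (∸-monoˡ-< z<N (≮⇒≥ z≮r))))
                       (m∸n+n≡m (≮⇒≥ z≮r))

  σ : PositionBijection (suc N)
  σ = record { to = f ; from = g ; to-< = f-< ; from-< = g-< ; from-to = g-f ; to-from = f-g }
    where
    f-< : ∀ {x} → x < suc N → f x < suc N
    f-< {zero} _ = z<s
    f-< {suc y} (s≤s y<N) = s≤s (shift-< y<N)
    g-< : ∀ {x} → x < suc N → g x < suc N
    g-< {zero} _ = z<s
    g-< {suc z} (s≤s z<N) = s≤s (unshift-< z<N)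
    g-f : ∀ {x} → x < suc N → g (f x) ≡ x
    g-f {zero} _ = refl
    g-f {suc y} (s≤s y<N) = cong suc (unshift-shift y<N)
    f-g : ∀ {x} → x < suc N → f (g x) ≡ x
    f-g {zero} _ = refl
    f-g {suc z} (s≤s z<N) = cong suc (shift-unshift z<N)

  f-last : ∀ {x} → x ≡ N → 0 < r → f x ≡ r
  f-last {zero} 0≡N 0<r = ⊥-elim (<⇒≢ 0<r (sym (m+n≡0⇒n≡0 j (trans j+r≡N (sym 0≡N)))))
  f-last {suc y} 1+y≡N 0<r = begin
    suc (shift y) ≡⟨ cong suc (shift-above j≤y) ⟩
    suc (y ∸ j)   ≡⟨ +-∸-assoc 1 j≤y ⟨
    suc y ∸ j     ≡⟨ cong (_∸ j) 1+y≡N ⟩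
    N ∸ j         ≡⟨ N∸j≡r ⟩
    r             ∎
    where
    open ≡-Reasoning
    j≤y : j ≤ y
    j≤y = s≤s⁻¹ (subst (suc j ≤_) (trans j+r≡N (sym 1+y≡N)) (subst (_≤ j + r) (+-comm j 1) (+-monoʳ-≤ j 0<r)))

  f-front : ∀ {x} → 0 < x → x ≤ j → x + r ≤ f x
  f-front {suc y} _ y<j = ≤-reflexive (cong suc (sym (shift-below y<j)))

  Clean : ℕ → ℕ → Set
  Clean a b = Spans (suc j) a b → a ⊓ b ≡ 0 × a ⊔ b ≡ N

  clean-sym : ∀ {a b} → Clean a b → Clean b a
  clean-sym {a} {b} c sp with c (spans-sym sp)
  ... | lo≡0 , hi≡N = trans (⊓-comm b a) lo≡0 , trans (⊔-comm b a) hi≡N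

  clean-at-0 : ∀ {a b} → a ≤ j → j < b → Clean a b → a ≡ 0
  clean-at-0 {a} {b} a≤j j<b c = trans (sym (m≤n⇒m⊓n≡m a≤b)) (proj₁ (c spans))
    where
    a≤b : a ≤ b
    a≤b = ≤-trans a≤j (<⇒≤ j<b)
    spans : Spans (suc j) a b
    spans = ≤-<-trans (m⊓n≤m a b) (s≤s a≤j) , ≤-trans j<b (m≤n⊔m a b)

  Front Back : ℕ → Set
  Front x = x ≤ j
  Back x = x ≡ 0 ⊎ (j < x × x ≤ N)

  side : ∀ {a b} → a ≤ N → b ≤ N → Clean a b → (Front a × Front b) ⊎ (Back a × Back b)
  side {a} {b} a≤N b≤N c with j <? a | j <? b
  ... | no a≯j | no b≯j = inj₁ (≮⇒≥ a≯j , ≮⇒≥ b≯j)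
  ... | yes j<a | yes j<b = inj₂ (inj₂ (j<a , a≤N) , inj₂ (j<b , b≤N))
  ... | no a≯j | yes j<b = inj₂ (inj₁ (clean-at-0 (≮⇒≥ a≯j) j<b c) , inj₂ (j<b , b≤N))
  ... | yes j<a | no b≯j = inj₂ (inj₂ (j<a , a≤N) , inj₁ (clean-at-0 (≮⇒≥ b≯j) j<a (clean-sym c)))

  increasing-on-front : ∀ {x y} → Front x → Front y → x < y → f x < f y
  increasing-on-front {zero} {suc y} _ _ _ = z<s
  increasing-on-front {suc x} {suc y} x<j y<j (s≤s x<y) rewrite shift-below x<j | shift-below y<j =
    s≤s (+-monoˡ-< r x<y)

  increasing-on-back : ∀ {x y} → Back x → Back y → x < y → f x < f y
  increasing-on-back {zero} {suc y} _ _ _ = z<s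
  increasing-on-back {suc x} {suc y} (inj₂ (s≤s j≤x , _)) (inj₂ (s≤s j≤y , _)) (s≤s x<y)
    rewrite shift-above j≤x | shift-above j≤y = s≤s (∸-monoˡ-< x<y j≤x)

  f-front-image : ∀ {x} → Front x → f x ≡ 0 ⊎ r < f x
  f-front-image {zero} _ = inj₁ refl
  f-front-image {suc x} x<j rewrite shift-below x<j = inj₂ (s≤s (m≤n+m r x))

  f-back-image : ∀ {x} → Back x → f x ≤ r
  f-back-image {zero} _ = z≤n
  f-back-image {suc x} (inj₂ (s≤s j≤x , 1+x≤N)) rewrite shift-above j≤x =
    subst (_≤ r) (+-∸-assoc 1 j≤x) (subst (suc x ∸ j ≤_) N∸j≡r (∸-monoˡ-≤ j 1+x≤N))

  front-outside-back : ∀ {x c d} → Front x → Back c → Back d → ¬ Between (f c) (f d) (f x)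
  front-outside-back fx bc bd (lo< , <hi) with f-front-image fx
  ... | inj₁ fx≡0 = n≮0 (subst (_ <_) fx≡0 lo<)
  ... | inj₂ r<fx = <-asym (<-≤-trans <hi (⊔-lub (f-back-image bc) (f-back-image bd))) r<fx

  reflects-crosses : ∀ {a b c d} → a ≤ N → b ≤ N → c ≤ N → d ≤ N → Clean a b → Clean c d →
                     Crosses (f a) (f b) (f c) (f d) → Crosses a b c d
  reflects-crosses a≤N b≤N c≤N d≤N cab ccd cr with side a≤N b≤N cab | side c≤N d≤N ccd
  ... | inj₁ (fa , fb) | inj₁ (fc , fd) = MonotoneOn.reflects-crosses Front f increasing-on-front fa fb fc fd cr
  ... | inj₂ (ba , bb) | inj₂ (bc , bd) = MonotoneOn.reflects-crosses Back f increasing-on-back ba bb bc bd cr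
  ... | inj₁ (fa , fb) | inj₂ (bc , bd) =
    ⊥-elim (separated⇒¬crosses (front-outside-back fa bc bd) (front-outside-back fb bc bd) (crosses-sym cr))
  ... | inj₂ (ba , bb) | inj₁ (fc , fd) =
    ⊥-elim (separated⇒¬crosses (front-outside-back fc ba bb) (front-outside-back fd ba bb) cr)

  length-≤-ordered : ∀ {a b} → a ≤ b → Clean a b → ¬ (a ≡ 0 × b ≡ N) → ∣ a - b ∣ ≤ ∣ f a - f b ∣
  length-≤-ordered {zero} {zero} _ _ _ = z≤n
  length-≤-ordered {zero} {suc b} _ c ¬0N with b <? j
  ... | yes b<j = m≤m+n (suc b) r
  ... | no b≮j = ⊥-elim (¬0N (refl , proj₂ (c (z<s , s≤s (≮⇒≥ b≮j)))))
  length-≤-ordered {suc a} {suc b} (s≤s a≤b) c _ with a <? j | b <? j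
  ... | yes _ | yes _ = ≤-reflexive (sym (trans (cong₂ ∣_-_∣ (+-comm a r) (+-comm b r)) (∣m+n-m+o∣≡∣n-o∣ r a b)))
  ... | no a≮j | no b≮j = ≤-reflexive (sym (∣-∣-∸ (≮⇒≥ a≮j) (≮⇒≥ b≮j)))
  ... | yes a<j | no b≮j with c (s≤s (≤-<-trans (m⊓n≤m a b) a<j) , s≤s (≤-trans (≮⇒≥ b≮j) (m≤n⊔m a b)))
  ...   | ()
  length-≤-ordered {suc a} {suc b} (s≤s a≤b) c _ | no a≮j | yes b<j = ⊥-elim (a≮j (≤-<-trans a≤b b<j))

  length-≤ : ∀ {a b} → a ≤ N → b ≤ N → Clean a b → ¬ (a ⊓ b ≡ 0 × a ⊔ b ≡ N) →
             ∣ a - b ∣ ≤ ∣ f a - f b ∣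
  length-≤ {a} {b} a≤N b≤N c ¬0N with ≤-total a b
  ... | inj₁ a≤b = length-≤-ordered a≤b c
                     λ (a≡0 , b≡N) → ¬0N (trans (m≤n⇒m⊓n≡m a≤b) a≡0 , trans (m≤n⇒m⊔n≡n a≤b) b≡N)
  ... | inj₂ b≤a = subst₂ _≤_ (∣-∣-comm b a) (∣-∣-comm (f b) (f a)) (length-≤-ordered b≤a (clean-sym c)
                     λ (b≡0 , a≡N) → ¬0N (trans (m≥n⇒m⊓n≡n b≤a) b≡0 , trans (m≥n⇒m⊔n≡m b≤a) a≡N))

-- Lists, sums and finite search

module _ {A : Set} where
  sum-map-mono-≤ : ∀ (g h : A → ℕ) xs → (∀ {x} → x ∈ xs → g x ≤ h x) → sum (map g xs) ≤ sum (map h xs)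
  sum-map-mono-≤ g h [] _ = z≤n
  sum-map-mono-≤ g h (x ∷ xs) g≤h = +-mono-≤ (g≤h (here refl)) (sum-map-mono-≤ g h xs (g≤h ∘ there))

  sum-map-mono-< : ∀ (g h : A → ℕ) xs → (∀ {x} → x ∈ xs → g x ≤ h x) →
                   ∀ {x₀} → x₀ ∈ xs → g x₀ < h x₀ → sum (map g xs) < sum (map h xs)
  sum-map-mono-< g h (x ∷ xs) g≤h (here refl) g<h = +-mono-<-≤ g<h (sum-map-mono-≤ g h xs (g≤h ∘ there))
  sum-map-mono-< g h (x ∷ xs) g≤h (there x₀∈) g<h =
    +-mono-≤-< (g≤h (here refl)) (sum-map-mono-< g h xs (g≤h ∘ there) x₀∈ g<h)

  sum-map-+ : ∀ (g h : A → ℕ) xs → sum (map (λ x → g x + h x) xs) ≡ sum (map g xs) + sum (map h xs)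
  sum-map-+ g h [] = refl
  sum-map-+ g h (x ∷ xs) = trans (cong (g x + h x +_) (sum-map-+ g h xs)) (interchange (g x) (h x) _ _)

  module _ {P : A → Set} (P? : Decidable P) where
    sum-map-indicator : ∀ k xs → sum (map (λ x → if does (P? x) then k else 0) xs) ≡ k * length (filter P? xs)
    sum-map-indicator k [] = sym (*-zeroʳ k)
    sum-map-indicator k (x ∷ xs) with does (P? x)
    ... | true = trans (cong (k +_) (sum-map-indicator k xs)) (sym (*-suc k _))
    ... | false = sum-map-indicator k xs

    length-filter-≤1 : ∀ {Q : A → Set} {xs} → All (λ x → P x → Q x) xs → AllPairs (λ x y → Q x → ¬ Q y) xs →
                       length (filter P? xs) ≤ 1
    length-filter-≤1 {xs = []} [] [] = z≤n
    length-filter-≤1 {xs = x ∷ xs} (P⇒Q ∷ P⇒Qs) (once ∷ rest) with P? x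
    ... | yes px = s≤s (≤-reflexive (cong length (filter-none P? (All.zipWith none (P⇒Qs , once)))))
      where none : ∀ {y} → (P y → _) × (_ → ¬ _) → ¬ P y
            none (P⇒Qy , ¬Qy) py = ¬Qy (P⇒Q px) (P⇒Qy py)
    ... | no _ = length-filter-≤1 P⇒Qs rest

  ∈-remove : ∀ {x y} {ys : List A} (x∈ys : x ∈ ys) → y ∈ ys → y ≢ x → y ∈ (ys ─ x∈ys)
  ∈-remove (here refl) (here refl) y≢x = ⊥-elim (y≢x refl)
  ∈-remove (here _) (there y∈ys) _ = y∈ys
  ∈-remove (there _) (here refl) _ = here refl
  ∈-remove (there x∈ys) (there y∈ys) y≢x = there (∈-remove x∈ys y∈ys y≢x)

  unique⇒length≤ : ∀ {xs ys : List A} → Unique xs → (∀ {x} → x ∈ xs → x ∈ ys) → length xs ≤ length ys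
  unique⇒length≤ {[]} _ _ = z≤n
  unique⇒length≤ {x ∷ xs} {ys} (x≢xs ∷ u) xs⊆ys =
    subst (suc (length xs) ≤_) (sym (length-removeAt′ ys (Any.index x∈ys)))
      (s≤s (unique⇒length≤ u λ y∈xs →
        ∈-remove x∈ys (xs⊆ys (there y∈xs)) λ y≡x → All.lookup x≢xs y∈xs (sym y≡x)))
    where
    x∈ys : x ∈ ys
    x∈ys = xs⊆ys (here refl)

  unique-∷ : ∀ {x} {xs : List A} → x ∉ xs → Unique xs → Unique (x ∷ xs)
  unique-∷ x∉xs u = ¬Any⇒All¬ _ x∉xs ∷ u

missing-element : ∀ {n} (xs : List (Fin n)) → Unique xs → length xs < n → ∃ λ y → y ∉ xs
missing-element {n} xs u |xs|<n with Finₚ.all? (λ y → ∈-dec _≟ᶠ_ y xs)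
... | yes all∈ = ⊥-elim (<⇒≱ |xs|<n
      (subst (_≤ length xs) (length-tabulate id) (unique⇒length≤ (allFin⁺ n) λ {y} _ → all∈ y)))
... | no ¬all∈ = Finₚ.¬∀⟶∃¬ n _ (λ y → ∈-dec _≟ᶠ_ y xs) ¬all∈

module _ {n : ℕ} {D : Fin n → Set} (D? : Decidable D) (h : Fin n → ℕ) where
  maximiser : ∀ {x} → D x → ∃ λ y → D y × (∀ {z} → D z → h z ≤ h y)
  maximiser {x} Dx = argmax h x ys , argmax-all h Dx (all-filter D? (allFin n))
                   , λ Dz → All.lookup (f[xs]≤f[argmax] {f = h} x ys) (∈-filter⁺ D? (∈-allFin _) Dz)
    where
    ys : List (Fin n)
    ys = filter D? (allFin n)

  minimiser : ∀ {x} → D x → ∃ λ y → D y × (∀ {z} → D z → h y ≤ h z)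
  minimiser {x} Dx = argmin h x ys , argmin-all h Dx (all-filter D? (allFin n))
                   , λ Dz → All.lookup (f[argmin]≤f[xs] {f = h} x ys) (∈-filter⁺ D? (∈-allFin _) Dz)
    where
    ys : List (Fin n)
    ys = filter D? (allFin n)

search-interval : ∀ {P : ℕ → Set} → Decidable P → ∀ a b →
                  (∃ λ k → a < k × k ≤ b × P k) ⊎ (∀ {k} → a < k → k ≤ b → ¬ P k)
search-interval P? a zero = inj₂ λ a<k k≤0 _ → <⇒≱ (<-≤-trans a<k k≤0) z≤n
search-interval P? a (suc b) with search-interval P? a b | a <? suc b | P? (suc b)
... | inj₁ (k , a<k , k≤b , pk) | _ | _ = inj₁ (k , a<k , m≤n⇒m≤1+n k≤b , pk)
... | inj₂ _ | yes a<1+b | yes p = inj₁ (suc b , a<1+b , ≤-refl , p)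
... | inj₂ none | yes _ | no ¬p = inj₂ λ {k} a<k k≤1+b →
      [ (λ k<1+b → none a<k (s≤s⁻¹ k<1+b)) , (λ { refl → ¬p }) ]′ (m≤n⇒m<n∨m≡n k≤1+b)
... | inj₂ _ | no a≮1+b | _ = inj₂ λ a<k k≤1+b → ⊥-elim (a≮1+b (<-≤-trans a<k k≤1+b))

Star-exit : ∀ {I : Set} {R : I → I → Set} {In : I → Set} → Decidable In →
            ∀ {s t} → Star R s t → In s → ¬ In t → ∃ λ c → ∃ λ d → In c × ¬ In d × R c d
Star-exit In? ε s∈ t∉ = ⊥-elim (t∉ s∈)
Star-exit In? {s} (_◅_ {j = m} s-m m⇝t) s∈ t∉ with In? m
... | yes m∈ = Star-exit In? m⇝t m∈ t∉
... | no m∉ = s , m , s∈ , m∉ , s-m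

-- Graphs and trees

module _ {n : ℕ} where
  Joins : Fin n × Fin n → Fin n → Fin n → Set
  Joins e x y = e ≡ (x , y) ⊎ e ≡ (y , x)

  joins? : ∀ e x y → Dec (Joins e x y)
  joins? e x y = ≡-dec _≟ᶠ_ _≟ᶠ_ e (x , y) ⊎-dec ≡-dec _≟ᶠ_ _≟ᶠ_ e (y , x)

  joins-sym : ∀ {e x y} → Joins e x y → Joins e y x
  joins-sym = swap

  joins-injective : ∀ {e x y z} → Joins e x y → Joins e x z → y ≡ z
  joins-injective (inj₁ refl) (inj₁ refl) = refl
  joins-injective (inj₁ refl) (inj₂ refl) = refl
  joins-injective (inj₂ refl) (inj₁ refl) = refl
  joins-injective (inj₂ refl) (inj₂ refl) = refl

  joins-endpoint : ∀ {e x y a b} → Joins e x y → Joins e a b → x ≡ a ⊎ x ≡ b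
  joins-endpoint (inj₁ refl) (inj₁ refl) = inj₁ refl
  joins-endpoint (inj₁ refl) (inj₂ refl) = inj₂ refl
  joins-endpoint (inj₂ refl) (inj₁ refl) = inj₂ refl
  joins-endpoint (inj₂ refl) (inj₂ refl) = inj₁ refl

  Incident : Fin n → Fin n × Fin n → Set
  Incident v e = proj₁ e ≡ v ⊎ proj₂ e ≡ v

  incident? : ∀ v e → Dec (Incident v e)
  incident? v e = (proj₁ e ≟ᶠ v) ⊎-dec (proj₂ e ≟ᶠ v)

  module _ {E : Edges n} where
    adj⇒edge : ∀ {x y} → Adj E x y → ∃ λ e → e ∈ E × Joins e x y
    adj⇒edge (inj₁ xy∈E) = _ , xy∈E , inj₁ refl
    adj⇒edge (inj₂ yx∈E) = _ , yx∈E , inj₂ refl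

    edge⇒adj : ∀ {e x y} → e ∈ E → Joins e x y → Adj E x y
    edge⇒adj e∈E (inj₁ refl) = inj₁ e∈E
    edge⇒adj e∈E (inj₂ refl) = inj₂ e∈E

    adj-sym : ∀ {x y} → Adj E x y → Adj E y x
    adj-sym = swap

    adj? : ∀ x y → Dec (Adj E x y)
    adj? x y = ∈-dec (≡-dec _≟ᶠ_ _≟ᶠ_) (x , y) E ⊎-dec ∈-dec (≡-dec _≟ᶠ_ _≟ᶠ_) (y , x) E

    adj⇒≢ : Simple E → ∀ {x y} → Adj E x y → x ≢ y
    adj⇒≢ (no-loop , _) (inj₁ xx∈E) refl = no-loop _ xx∈E
    adj⇒≢ (no-loop , _) (inj₂ xx∈E) refl = no-loop _ xx∈E

joins-at-most-once : ∀ {n} {F : Edges n} x y → (∀ xs ys u v → F ≡ xs ++ ys → (u , v) ∈ xs → ¬ Adj ys u v) →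
                     AllPairs (λ e f → Joins e x y → ¬ Joins f x y) F
joins-at-most-once {F = []} _ _ _ = []
joins-at-most-once {F = e ∷ F} x y no-repeat =
  All.tabulate (λ f∈F e-xy f-xy →
    no-repeat (e ∷ []) F (proj₁ e) (proj₂ e) refl (here refl) (edge⇒adj f∈F (same-pair e-xy f-xy)))
  ∷ joins-at-most-once x y (λ xs ys u v eq → no-repeat (e ∷ xs) ys u v (cong (e ∷_) eq) ∘ there)
  where
  same-pair : ∀ {e f} → Joins e x y → Joins f x y → Joins f (proj₁ e) (proj₂ e)
  same-pair (inj₁ refl) f-xy = f-xy
  same-pair (inj₂ refl) f-xy = joins-sym f-xy

other-neighbour : ∀ {n} {E : Edges n} {x y} → Simple E → Adj E x y → ¬ Leaf E x → ∃ λ w → Adj E x w × w ≢ y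
other-neighbour {E = E} {x} {y} (_ , no-repeat) x-y ¬leaf
  with adj⇒edge x-y | all? (λ e → incident? x e →-dec joins? e x y) E
... | _ , e∈E , e-xy | yes incident⇒joins = ⊥-elim (¬leaf (≤-antisym
      (length-filter-≤1 (incident? x) incident⇒joins (joins-at-most-once x y no-repeat))
      (filter-some (incident? x) (Any.map (λ { refl → incident e-xy }) e∈E))))
  where
  incident : ∀ {e} → Joins e x y → Incident x e
  incident (inj₁ refl) = inj₁ refl
  incident (inj₂ refl) = inj₂ refl
... | _ | no ¬incident⇒joins with Mem.find (¬All⇒Any¬ (λ e → incident? x e →-dec joins? e x y) E ¬incident⇒joins)
...   | (u , v) , uv∈E , ¬[incident⇒joins] with u ≟ᶠ x | v ≟ᶠ x
...     | yes refl | _ = v , inj₁ uv∈E , λ { refl → ¬[incident⇒joins] λ _ → inj₁ refl }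
...     | no _ | yes refl = u , inj₂ uv∈E , λ { refl → ¬[incident⇒joins] λ _ → inj₂ refl }
...     | no u≢x | no v≢x = ⊥-elim (¬[incident⇒joins] [ ⊥-elim ∘ u≢x , ⊥-elim ∘ v≢x ]′)

module _ {n : ℕ} (F : Edges n) (connected : Connected F) where
  record Subtree (m : ℕ) : Set where
    field
      vertices : List (Fin n)
      edges : Edges n
      vertices-unique : Unique vertices
      edges-unique : Unique edges
      #vertices : length vertices ≡ suc m
      #edges : length edges ≡ m
      edges⊆F : ∀ {e} → e ∈ edges → e ∈ F
      ends∈ : ∀ {e} → e ∈ edges → proj₁ e ∈ vertices × proj₂ e ∈ vertices
  open Subtree

  some-vertex : ∀ {m} (T : Subtree m) → ∃ λ v → v ∈ vertices T
  some-vertex T with vertices T | #vertices T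
  ... | v ∷ _ | _ = v , here refl

  extend : ∀ {m} (T : Subtree m) → length (vertices T) < n → Subtree (suc m)
  extend T short with missing-element (vertices T) (vertices-unique T) short | some-vertex T
  ... | t , t∉ | v₀ , v₀∈ with Star-exit (λ v → ∈-dec _≟ᶠ_ v (vertices T)) (connected v₀ t) v₀∈ t∉
  ...   | c , d , c∈ , d∉ , c-d with adj⇒edge c-d
  ...     | e , e∈F , e-cd = record
    { vertices = d ∷ vertices T ; edges = e ∷ edges T
    ; vertices-unique = unique-∷ d∉ (vertices-unique T) ; edges-unique = unique-∷ e∉ (edges-unique T)
    ; #vertices = cong suc (#vertices T) ; #edges = cong suc (#edges T)
    ; edges⊆F = λ { (here refl) → e∈F ; (there f∈) → edges⊆F T f∈ }
    ; ends∈ = λ { (here refl) → new-ends e-cd ; (there f∈) → Data.Product.map there there (ends∈ T f∈) } }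
    where
    e∉ : e ∉ edges T
    e∉ e∈ = [ (λ { refl → d∉ (proj₂ (ends∈ T e∈)) }) , (λ { refl → d∉ (proj₁ (ends∈ T e∈)) }) ]′ e-cd
    new-ends : Joins e c d → proj₁ e ∈ d ∷ vertices T × proj₂ e ∈ d ∷ vertices T
    new-ends (inj₁ refl) = there c∈ , here refl
    new-ends (inj₂ refl) = here refl , there c∈

  grow : ∀ m → m < n → Subtree m
  grow zero 0<n = record
    { vertices = fromℕ< 0<n ∷ [] ; edges = [] ; vertices-unique = [] ∷ [] ; edges-unique = []
    ; #vertices = refl ; #edges = refl ; edges⊆F = λ () ; ends∈ = λ () }
  grow (suc m) 1+m<n with grow m (<⇒≤ 1+m<n)
  ... | T = extend T (subst (_< n) (sym (#vertices T)) 1+m<n)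

connected⇒size : ∀ {N} (F : Edges (suc N)) → Connected F → N ≤ length F
connected⇒size {N} F connected =
  subst (_≤ length F) (#edges T) (unique⇒length≤ (edges-unique T) (edges⊆F T))
  where
  open Subtree
  T : Subtree F connected N
  T = grow F connected N ≤-refl

-- Arrangements

module Arrangements {N : ℕ} (E : Edges (suc N)) where
  Vertex : Set
  Vertex = Fin (suc N)

  Arr : Set
  Arr = Arrangement (suc N)

  pos≤N : ∀ (π : Arr) x → pos π x ≤ N
  pos≤N π x = s≤s⁻¹ (toℕ<n (π ⟨$⟩ʳ x))

  pos-injective : ∀ (π : Arr) {x y} → pos π x ≡ pos π y → x ≡ y
  pos-injective π {x} {y} eq = trans (sym (inverseˡ π)) (trans (cong (π ⟨$⟩ˡ_) (toℕ-injective eq)) (inverseˡ π))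

  vertex-at : ∀ (π : Arr) {k} → k ≤ N → ∃ λ x → pos π x ≡ k
  vertex-at π k≤N = π ⟨$⟩ˡ fromℕ< (s≤s k≤N) , trans (cong toℕ (inverseʳ π)) (toℕ-fromℕ< _)

  pos₁ pos₂ : Arr → Vertex × Vertex → ℕ
  pos₁ π e = pos π (proj₁ e)
  pos₂ π e = pos π (proj₂ e)

  edgeLength : (ℕ → ℕ) → Arr → Vertex × Vertex → ℕ
  edgeLength f π e = ∣ f (pos₁ π e) - f (pos₂ π e) ∣

  hi≤N : ∀ (π : Arr) e → hi π e ≤ N
  hi≤N π e = ⊔-lub (pos≤N π (proj₁ e)) (pos≤N π (proj₂ e))

  lo-joins : ∀ (π : Arr) {e x y} → Joins e x y → lo π e ≡ pos π x ⊓ pos π y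
  lo-joins π (inj₁ refl) = refl
  lo-joins π {x = x} {y} (inj₂ refl) = ⊓-comm (pos π y) (pos π x)

  hi-joins : ∀ (π : Arr) {e x y} → Joins e x y → hi π e ≡ pos π x ⊔ pos π y
  hi-joins π (inj₁ refl) = refl
  hi-joins π {x = x} {y} (inj₂ refl) = ⊔-comm (pos π y) (pos π x)

  edgeLength-joins : ∀ f (π : Arr) {e x y} → Joins e x y → edgeLength f π e ≡ ∣ f (pos π x) - f (pos π y) ∣
  edgeLength-joins f π (inj₁ refl) = refl
  edgeLength-joins f π {x = x} {y} (inj₂ refl) = ∣-∣-comm (f (pos π y)) (f (pos π x))

  endpoints : ∀ (π : Arr) e → ∃ λ xl → ∃ λ xh → Joins e xl xh × pos π xl ≡ lo π e × pos π xh ≡ hi π e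
  endpoints π (u , v) with ≤-total (pos π u) (pos π v)
  ... | inj₁ u≤v = u , v , inj₁ refl , sym (m≤n⇒m⊓n≡m u≤v) , sym (m≤n⇒m⊔n≡n u≤v)
  ... | inj₂ v≤u = v , u , inj₂ refl , sym (m≥n⇒m⊓n≡n v≤u) , sym (m≥n⇒m⊔n≡m v≤u)

  planar⇒¬interleaved : ∀ {π e f} → Planar E π → e ∈ E → f ∈ E →
                        lo π e < lo π f → lo π f < hi π e → hi π e < hi π f → ⊥
  planar⇒¬interleaved planar e∈E f∈E p q r = planar _ _ e∈E f∈E (inj₁ (p , q , r))

  PlanarMax : Arr → Set
  PlanarMax π = Planar E π × (∀ π′ → Planar E π′ → cost E π′ ≤ cost E π)

  module _ (σ : PositionBijection (suc N)) (π : Arr) where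
    open PositionBijection σ

    cost-rearrange : cost E (rearrange σ π) ≡ sum (map (edgeLength to π) E)
    cost-rearrange =
      cong sum (map-cong (λ e → cong₂ ∣_-_∣ (pos-rearrange σ π (proj₁ e)) (pos-rearrange σ π (proj₂ e))) E)

    planar-rearrange : (∀ {e f} → e ∈ E → f ∈ E →
                         Crosses (to (pos₁ π e)) (to (pos₂ π e)) (to (pos₁ π f)) (to (pos₂ π f)) → Cross π e f) →
                       Planar E π → Planar E (rearrange σ π)
    planar-rearrange reflects planar e f e∈E f∈E cr = planar e f e∈E f∈E (reflects e∈E f∈E
      (subst₂ (λ a b → Crosses a b _ _) (pos-rearrange σ π (proj₁ e)) (pos-rearrange σ π (proj₂ e))
        (subst₂ (λ c d → Crosses _ _ c d) (pos-rearrange σ π (proj₁ f)) (pos-rearrange σ π (proj₂ f)) cr)))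

    planar-max-unimprovable : PlanarMax π → Planar E (rearrange σ π) → sum (map (edgeLength to π) E) ≤ cost E π
    planar-max-unimprovable (_ , max) planar = subst (_≤ cost E π) cost-rearrange (max (rearrange σ π) planar)

  reflect : Arr → Arr
  reflect = rearrange (Reflection.σ N)

  pos-reflect : ∀ (π : Arr) x → pos (reflect π) x ≡ N ∸ pos π x
  pos-reflect = pos-rearrange (Reflection.σ N)

  last⇒first-in-reflect : ∀ {π x} → pos π x ≡ N → pos (reflect π) x ≡ 0
  last⇒first-in-reflect {π} {x} x-at-N = trans (pos-reflect π x) (trans (cong (N ∸_) x-at-N) (n∸n≡0 N))

  planar-reflect : ∀ {π} → Planar E π → Planar E (reflect π)
  planar-reflect {π} = planar-rearrange (Reflection.σ N) π λ _ _ →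
    Reflection.reflects-crosses N (pos≤N π _) (pos≤N π _) (pos≤N π _) (pos≤N π _)

  cost-reflect : ∀ (π : Arr) → cost E (reflect π) ≡ cost E π
  cost-reflect π = trans (cost-rearrange (Reflection.σ N) π)
                         (cong sum (map-cong (λ e → ∣-∣-reflect (pos≤N π (proj₁ e)) (pos≤N π (proj₂ e))) E))

  reflect-planar-max : ∀ {π} → PlanarMax π → PlanarMax (reflect π)
  reflect-planar-max {π} (planar , max) =
    planar-reflect {π} planar , λ π′ planar′ → subst (cost E π′ ≤_) (sym (cost-reflect π)) (max π′ planar′)

  lo-reflect : ∀ (π : Arr) e → lo (reflect π) e ≡ N ∸ hi π e
  lo-reflect π e rewrite pos-reflect π (proj₁ e) | pos-reflect π (proj₂ e) =
    sym (Reflection.h-⊔ N (pos≤N π (proj₁ e)) (pos≤N π (proj₂ e)))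

  hi-reflect : ∀ (π : Arr) e → hi (reflect π) e ≡ N ∸ lo π e
  hi-reflect π e rewrite pos-reflect π (proj₁ e) | pos-reflect π (proj₂ e) =
    sym (Reflection.h-⊓ N (pos≤N π (proj₁ e)) (pos≤N π (proj₂ e)))

  HingedAt : Arr → ℕ → Set
  HingedAt π q = ∀ {e} → e ∈ E → Spans q (pos₁ π e) (pos₂ π e) → hi π e ≡ q

  planar-max⇒¬hinged : ∀ {π q} → PlanarMax π → q < N → HingedAt π q →
                       ∀ {e₀} → e₀ ∈ E → lo π e₀ < q → hi π e₀ ≡ q → ⊥
  planar-max⇒¬hinged {π} {q} max q<N hinged e₀∈E lo<q hi≡q =
    <⇒≱ longer (planar-max-unimprovable σ π max planar)
    where
    open SuffixReversal N q (<⇒≤ q<N)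
    planar : Planar E (rearrange σ π)
    planar = planar-rearrange σ π (λ e∈E f∈E → reflects-crosses (pos≤N π _) (pos≤N π _) (pos≤N π _) (pos≤N π _)
                                                  (hinged e∈E) (hinged f∈E)) (proj₁ max)
    longer : cost E π < sum (map (edgeLength f π) E)
    longer = sum-map-mono-< _ _ E (λ e∈E → length-≤ (pos≤N π _) (pos≤N π _) (hinged e∈E))
                            e₀∈E (length-< lo<q hi≡q q<N)

  CleanCut : Arr → ℕ → Set
  CleanCut π k = All (λ e → Spans k (pos₁ π e) (pos₂ π e) → lo π e ≡ 0 × hi π e ≡ N) E

  clean-cut? : ∀ (π : Arr) k → Dec (CleanCut π k)
  clean-cut? π k = all? (λ e → ((lo π e <? k) ×-dec (k ≤? hi π e)) →-dec ((lo π e ≟ 0) ×-dec (hi π e ≟ N))) E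

  clean-cut-reflect : ∀ {π j} → CleanCut π (suc j) → CleanCut (reflect π) (N ∸ j)
  clean-cut-reflect {π} {j} clean = All.tabulate λ {e} e∈E (lo′< , ≤hi′) →
    let j<hi = ∸-cancelʳ-< (subst (_< N ∸ j) (lo-reflect π e) lo′<)
        lo≤j = ∸-cancelʳ-≤ (≤-trans (m⊓n≤m _ _) (pos≤N π _)) (subst (N ∸ j ≤_) (hi-reflect π e) ≤hi′)
        (lo≡0 , hi≡N) = All.lookup clean e∈E (s≤s lo≤j , j<hi)
    in trans (lo-reflect π e) (trans (cong (N ∸_) hi≡N) (n∸n≡0 N)) , trans (hi-reflect π e) (cong (N ∸_) lo≡0)

  ¬clean-cut⇒spanning-edge : ∀ {π k} → ¬ CleanCut π k →
                             ∃ λ e → e ∈ E × Spans k (pos₁ π e) (pos₂ π e) × ¬ (lo π e ≡ 0 × hi π e ≡ N)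
  ¬clean-cut⇒spanning-edge {π} {k} ¬clean with Mem.find (¬All⇒Any¬ (λ e → ((lo π e <? k) ×-dec (k ≤? hi π e)) →-dec
                                                           ((lo π e ≟ 0) ×-dec (hi π e ≟ N))) E ¬clean)
  ... | e , e∈E , ¬clean-at-e with (lo π e <? k) ×-dec (k ≤? hi π e) | (lo π e ≟ 0) ×-dec (hi π e ≟ N)
  ...   | yes spans | no ¬0N = e , e∈E , spans , ¬0N
  ...   | yes _ | yes 0N = ⊥-elim (¬clean-at-e λ _ → 0N)
  ...   | no ¬spans | _ = ⊥-elim (¬clean-at-e λ spans → ⊥-elim (¬spans spans))

  edge-from-first : ∀ {π a x} → pos π a ≡ 0 → Adj E a x → ∃ λ e → e ∈ E × lo π e ≡ 0 × hi π e ≡ pos π x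
  edge-from-first {π} {x = x} a-at-0 a-x with adj⇒edge a-x
  ... | e , e∈E , e-ax = e , e∈E , trans (lo-joins π e-ax) (cong (_⊓ pos π x) a-at-0)
                                 , trans (hi-joins π e-ax) (cong (_⊔ pos π x) a-at-0)

  edge-to-last : ∀ {π b x} → pos π b ≡ N → Adj E b x → ∃ λ e → e ∈ E × lo π e ≡ pos π x × hi π e ≡ N
  edge-to-last {π} {x = x} b-at-N b-x with adj⇒edge b-x
  ... | e , e∈E , e-bx =
    e , e∈E , trans (lo-joins π e-bx) (trans (cong (_⊓ pos π x) b-at-N) (m≥n⇒m⊓n≡n (pos≤N π x)))
            , trans (hi-joins π e-bx) (trans (cong (_⊔ pos π x) b-at-N) (m≥n⇒m⊔n≡m (pos≤N π x)))

  first-edge⇒adj : ∀ {π a e} → pos π a ≡ 0 → e ∈ E → lo π e ≡ 0 → ∃ λ x → Adj E a x × pos π x ≡ hi π e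
  first-edge⇒adj {π} a-at-0 e∈E lo≡0 with endpoints π _
  ... | xl , xh , e-lh , xl-at-lo , xh-at-hi =
    xh , edge⇒adj e∈E (subst (λ x → Joins _ x xh) (pos-injective π (trans xl-at-lo (trans lo≡0 (sym a-at-0)))) e-lh)
       , xh-at-hi

  last-edge⇒adj : ∀ {π b e} → pos π b ≡ N → e ∈ E → hi π e ≡ N → ∃ λ x → Adj E b x × pos π x ≡ lo π e
  last-edge⇒adj {π} b-at-N e∈E hi≡N with endpoints π _
  ... | xl , xh , e-lh , xl-at-lo , xh-at-hi =
    xl , edge⇒adj e∈E (subst (λ x → Joins _ x xl) (pos-injective π (trans xh-at-hi (trans hi≡N (sym b-at-N))))
                             (joins-sym e-lh))
       , xl-at-lo

  InVStar⇒projective-planar-max : ∀ {v} → InVStar E v → ∃ λ π → Projective E v π × PlanarMax π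
  InVStar⇒projective-planar-max (m , (_ , planar≤m) , (π , projective , cost≡m) , _) =
    π , projective , proj₁ projective , λ π′ planar′ → subst (cost E π′ ≤_) (sym cost≡m) (planar≤m π′ planar′)

-- Maximum planar arrangements of a tree

module InTree {N : ℕ} (E : Edges (suc N)) (tree : IsTree (suc N) E) where
  open Arrangements E

  simple : Simple E
  simple = proj₁ tree

  connected : Connected E
  connected = proj₁ (proj₂ tree)

  Without : Vertex → Vertex → Edges (suc N)
  Without a b = filter (λ e → ¬? (joins? e a b)) E

  adj-without : ∀ {a b x y} → Adj E x y → (∀ {e} → Joins e x y → ¬ Joins e a b) → Adj (Without a b) x y
  adj-without {a} {b} x-y avoids with adj⇒edge x-y
  ... | e , e∈E , e-xy = edge⇒adj (∈-filter⁺ (λ e → ¬? (joins? e a b)) e∈E (avoids e-xy)) e-xy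

  -- Otherwise T without ab would be connected with fewer than N edges.
  no-detour : ∀ {a b} → Adj E a b → ¬ Star (Adj (Without a b)) a b
  no-detour {a} {b} a-b detour with adj⇒edge a-b
  ... | _ , ab∈E , e-ab = <⇒≱ fewer-edges (connected⇒size (Without a b) reconnected)
    where
    fewer-edges : length (Without a b) < N
    fewer-edges = subst (length (Without a b) <_) (suc-injective (proj₂ (proj₂ tree)))
                    (filter-notAll (λ e → ¬? (joins? e a b)) E (Any.map (λ { refl ¬e-ab → ¬e-ab e-ab }) ab∈E))
    through : ∀ {e p q} → Joins e p q → Joins e a b → Star (Adj (Without a b)) p q
    through (inj₁ refl) (inj₁ refl) = detour
    through (inj₁ refl) (inj₂ refl) = reverse adj-sym detour
    through (inj₂ refl) (inj₁ refl) = reverse adj-sym detour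
    through (inj₂ refl) (inj₂ refl) = detour
    step : ∀ {p q} → Adj E p q → Star (Adj (Without a b)) p q
    step p-q with adj⇒edge p-q
    ... | e , e∈E , e-pq with joins? e a b
    ...   | yes e-ab = through e-pq e-ab
    ...   | no ¬e-ab = edge⇒adj (∈-filter⁺ (λ e → ¬? (joins? e a b)) e∈E ¬e-ab) e-pq ◅ ε
    reconnected : Connected (Without a b)
    reconnected x y = connected x y >>= step

  cut-spanned : ∀ π {p} → 0 < p → p ≤ N → ∃ λ e → e ∈ E × Spans p (pos₁ π e) (pos₂ π e)
  cut-spanned π {p} 0<p p≤N with vertex-at π z≤n | vertex-at π p≤N
  ... | x₀ , x₀-at-0 | y , y-at-p
    with Star-exit (λ x → pos π x <? p) (connected x₀ y) (subst (_< p) (sym x₀-at-0) 0<p) (<-irrefl y-at-p)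
  ...   | c , d , c<p , d≮p , c-d with adj⇒edge c-d
  ...     | e , e∈E , e-cd = e , e∈E
            , ≤-<-trans (subst (_≤ pos π c) (sym (lo-joins π e-cd)) (m⊓n≤m _ _)) c<p
            , ≤-trans (≮⇒≥ d≮p) (subst (pos π d ≤_) (sym (hi-joins π e-cd)) (m≤n⊔m _ _))

  -- Projectivity makes the block from the root onwards hinged at the root.
  projective-max⇒root-at-end : ∀ {π v} → Projective E v π → PlanarMax π → pos π v ≡ 0 ⊎ pos π v ≡ N
  projective-max⇒root-at-end {π} {v} (_ , uncovered) max with pos π v ≟ 0 | pos π v ≟ N
  ... | yes v-at-0 | _ = inj₁ v-at-0
  ... | no _ | yes v-at-N = inj₂ v-at-N
  ... | no v≢0 | no v≢N with cut-spanned π (n≢0⇒n>0 v≢0) (pos≤N π v)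
  ...   | e , e∈E , spans =
    ⊥-elim (planar-max⇒¬hinged {π} max (≤∧≢⇒< (pos≤N π v) v≢N) hinged e∈E (proj₁ spans) (hinged e∈E spans))
    where
    hinged : HingedAt π (pos π v)
    hinged {e} e∈E (lo<v , v≤hi) = [ (λ v<hi → ⊥-elim (uncovered e e∈E (lo<v , v<hi))) , sym ]′ (m≤n⇒m<n∨m≡n v≤hi)

  neighbour-of-first : ∀ {π v} → pos π v ≡ 0 → 0 < N → ∃ λ u → Adj E v u
  neighbour-of-first {π} v-at-0 0<N with cut-spanned π z<s 0<N
  ... | e , e∈E , lo<1 , _ with first-edge⇒adj {π} v-at-0 e∈E (n<1⇒n≡0 lo<1)
  ...   | u , v-u , _ = u , v-u

  -- Were the farthest neighbour u of v not last, the block from u onwards would be hinged at u.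
  first⇒neighbour-last : ∀ {π v} → PlanarMax π → pos π v ≡ 0 → 0 < N → ∃ λ u → Adj E v u × pos π u ≡ N
  first⇒neighbour-last {π} {v} max v-at-0 0<N with neighbour-of-first {π} v-at-0 0<N
  ... | _ , v-u₀ with maximiser (adj? v) (pos π) v-u₀
  ...   | u , v-u , u-max with pos π u ≟ N | edge-from-first {π} v-at-0 v-u
  ...     | yes u-at-N | _ = u , v-u , u-at-N
  ...     | no u≢N | e , e∈E , lo≡0 , hi≡q =
    ⊥-elim (planar-max⇒¬hinged {π} max q<N hinged e∈E (subst (_< q) (sym lo≡0) 0<q) hi≡q)
    where
    q : ℕ
    q = pos π u
    q<N : q < N
    q<N = ≤∧≢⇒< (pos≤N π u) u≢N
    0<q : 0 < q
    0<q = n≢0⇒n>0 λ u-at-0 → adj⇒≢ simple v-u (pos-injective π (trans v-at-0 (sym u-at-0)))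
    hinged : HingedAt π q
    hinged {f} f∈E (lo<q , q≤hi) with m≤n⇒m<n∨m≡n q≤hi
    ... | inj₂ q≡hi = sym q≡hi
    ... | inj₁ q<hi with lo π f ≟ 0
    ...   | no lo≢0 = ⊥-elim (planar⇒¬interleaved {π} (proj₁ max) e∈E f∈E
                         (subst (_< lo π f) (sym lo≡0) (n≢0⇒n>0 lo≢0)) (subst (lo π f <_) (sym hi≡q) lo<q)
                         (subst (_< hi π f) (sym hi≡q) q<hi))
    ...   | yes lo≡0′ with first-edge⇒adj {π} v-at-0 f∈E lo≡0′
    ...     | x , v-x , x-at-hi = ⊥-elim (<⇒≱ q<hi (subst (_≤ q) x-at-hi (u-max v-x)))

  -- Exchanging the blocks shortens ab by j and lengthens ac by r; no other edge gets shorter.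
  block-swap-contradiction : ∀ {ρ a b c} j r → PlanarMax ρ → pos ρ a ≡ 0 → pos ρ b ≡ N → Adj E a b → Adj E a c →
                             0 < pos ρ c → pos ρ c ≤ j → j + r ≡ N → j < r → CleanCut ρ (suc j) → ⊥
  block-swap-contradiction {ρ} {a} {b} {c} j r max a-at-0 b-at-N a-b a-c 0<c c≤j j+r≡N j<r clean =
    <⇒≱ longer (planar-max-unimprovable σ ρ max planar)
    where
    open BlockSwap N j r j+r≡N
    j<N : j < N
    j<N = <-≤-trans j<r (subst (r ≤_) j+r≡N (m≤n+m r j))

    planar : Planar E (rearrange σ ρ)
    planar = planar-rearrange σ ρ (λ e∈E f∈E → reflects-crosses (pos≤N ρ _) (pos≤N ρ _) (pos≤N ρ _) (pos≤N ρ _)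
                                                  (All.lookup clean e∈E) (All.lookup clean f∈E)) (proj₁ max)

    gain loss : Vertex × Vertex → ℕ
    gain e = if does (joins? e a c) then r else 0
    loss e = if does (joins? e a b) then j else 0

    per-edge : ∀ {e} → e ∈ E → edgeLength id ρ e + gain e ≤ edgeLength f ρ e + loss e
    per-edge {e} e∈E = by-cases (joins? e a b) (joins? e a c)
      where
      by-cases : (ab? : Dec (Joins e a b)) (ac? : Dec (Joins e a c)) →
                 edgeLength id ρ e + (if does ac? then r else 0) ≤ edgeLength f ρ e + (if does ab? then j else 0)
      by-cases (yes e-ab) (yes e-ac) =
        ⊥-elim (<⇒≢ (≤-<-trans c≤j j<N) (trans (cong (pos ρ) (sym (joins-injective e-ab e-ac))) b-at-N))
      by-cases (yes e-ab) (no _) = ≤-reflexive (begin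
        edgeLength id ρ e + 0                 ≡⟨ +-identityʳ _ ⟩
        edgeLength id ρ e                     ≡⟨ edgeLength-joins id ρ e-ab ⟩
        ∣ pos ρ a - pos ρ b ∣                 ≡⟨ cong₂ ∣_-_∣ a-at-0 b-at-N ⟩
        N                                     ≡⟨ trans (sym j+r≡N) (+-comm j r) ⟩
        r + j                                 ≡⟨ cong (_+ j) (f-last b-at-N (≤-<-trans z≤n j<r)) ⟨
        f (pos ρ b) + j                       ≡⟨ cong (λ m → ∣ f m - f (pos ρ b) ∣ + j) a-at-0 ⟨
        ∣ f (pos ρ a) - f (pos ρ b) ∣ + j     ≡⟨ cong (_+ j) (edgeLength-joins f ρ e-ab) ⟨
        edgeLength f ρ e + j                  ∎)
        where open ≡-Reasoning
      by-cases (no _) (yes e-ac) = begin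
        edgeLength id ρ e + r                 ≡⟨ cong (_+ r) (edgeLength-joins id ρ e-ac) ⟩
        ∣ pos ρ a - pos ρ c ∣ + r             ≡⟨ cong (λ m → ∣ m - pos ρ c ∣ + r) a-at-0 ⟩
        pos ρ c + r                           ≤⟨ f-front 0<c c≤j ⟩
        f (pos ρ c)                           ≡⟨ cong (λ m → ∣ f m - f (pos ρ c) ∣) a-at-0 ⟨
        ∣ f (pos ρ a) - f (pos ρ c) ∣         ≡⟨ edgeLength-joins f ρ e-ac ⟨
        edgeLength f ρ e                      ≡⟨ +-identityʳ _ ⟨
        edgeLength f ρ e + 0                  ∎
        where open ≤-Reasoning
      by-cases (no ¬e-ab) (no _) = +-monoˡ-≤ 0 (length-≤ (pos≤N ρ _) (pos≤N ρ _) (All.lookup clean e∈E) not-ab)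
        where
        not-ab : ¬ (lo ρ e ≡ 0 × hi ρ e ≡ N)
        not-ab (lo≡0 , hi≡N) with endpoints ρ e
        ... | xl , xh , e-lh , xl-at-lo , xh-at-hi =
          ¬e-ab (subst₂ (Joins e) (pos-injective ρ (trans xl-at-lo (trans lo≡0 (sym a-at-0))))
                                  (pos-injective ρ (trans xh-at-hi (trans hi≡N (sym b-at-N)))) e-lh)

    #ac #ab : ℕ
    #ac = length (filter (λ e → joins? e a c) E)
    #ab = length (filter (λ e → joins? e a b) E)

    1≤#ac : 1 ≤ #ac
    1≤#ac with adj⇒edge a-c
    ... | _ , ac∈E , e-ac = filter-some (λ e → joins? e a c) (Any.map (λ { refl → e-ac }) ac∈E)

    #ab≤1 : #ab ≤ 1
    #ab≤1 = length-filter-≤1 (λ e → joins? e a b) (All.universal (λ _ → id) E) (joins-at-most-once a b (proj₂ simple))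

    new : ℕ
    new = sum (map (edgeLength f ρ) E)

    longer : cost E ρ < new
    longer = +-cancelʳ-< j (cost E ρ) new (begin-strict
      cost E ρ + j                                          <⟨ +-monoʳ-< (cost E ρ) j<r ⟩
      cost E ρ + r                                          ≡⟨ cong (cost E ρ +_) (*-identityʳ r) ⟨
      cost E ρ + r * 1                                      ≤⟨ +-monoʳ-≤ (cost E ρ) (*-monoʳ-≤ r 1≤#ac) ⟩
      cost E ρ + r * #ac                                    ≡⟨ cong (cost E ρ +_) (sum-map-indicator (λ e → joins? e a c) r E) ⟨
      sum (map (edgeLength id ρ) E) + sum (map gain E)      ≡⟨ sum-map-+ (edgeLength id ρ) gain E ⟨
      sum (map (λ e → edgeLength id ρ e + gain e) E)        ≤⟨ sum-map-mono-≤ _ _ E per-edge ⟩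
      sum (map (λ e → edgeLength f ρ e + loss e) E)         ≡⟨ sum-map-+ (edgeLength f ρ) loss E ⟩
      new + sum (map loss E)                                ≡⟨ cong (new +_) (sum-map-indicator (λ e → joins? e a b) j E) ⟩
      new + j * #ab                                         ≤⟨ +-monoʳ-≤ new (*-monoʳ-≤ j #ab≤1) ⟩
      new + j * 1                                           ≡⟨ cong (new +_) (*-identityʳ j) ⟩
      new + j                                               ∎)
      where open ≤-Reasoning

  module EndToEnd {π a b} (max : PlanarMax π) (a-at-0 : pos π a ≡ 0) (b-at-N : pos π b ≡ N) (a-b : Adj E a b) where
    planar : Planar E π
    planar = proj₁ max

    at-0 : ∀ {x} → pos π x ≡ 0 → x ≡ a
    at-0 x-at-0 = pos-injective π (trans x-at-0 (sym a-at-0))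

    at-N : ∀ {x} → pos π x ≡ N → x ≡ b
    at-N x-at-N = pos-injective π (trans x-at-N (sym b-at-N))

    module Innermost {w z} (a-w : Adj E a w) (w<N : pos π w < N)
                           (w-max : ∀ {x} → Adj E a x × pos π x < N → pos π x ≤ pos π w)
                           (b-z : Adj E b z) (0<z : 0 < pos π z)
                           (z-min : ∀ {x} → Adj E b x × 0 < pos π x → pos π z ≤ pos π x) where
      R S : ℕ
      R = pos π w
      S = pos π z

      0<R : 0 < R
      0<R = n≢0⇒n>0 λ w-at-0 → adj⇒≢ simple a-w (sym (at-0 w-at-0))

      S<N : S < N
      S<N = ≤∧≢⇒< (pos≤N π z) λ z-at-N → adj⇒≢ simple b-z (sym (at-N z-at-N))

      aw : ∃ λ e → e ∈ E × lo π e ≡ 0 × hi π e ≡ R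
      aw = edge-from-first {π} a-at-0 a-w

      bz : ∃ λ e → e ∈ E × lo π e ≡ S × hi π e ≡ N
      bz = edge-to-last {π} b-at-N b-z

      -- An edge reaching left of w would cross aw or give a a neighbour beyond w.
      R≤lo : ∀ {e k} → e ∈ E → R < k → Spans k (pos₁ π e) (pos₂ π e) → ¬ (lo π e ≡ 0 × hi π e ≡ N) →
             R ≤ lo π e
      R≤lo {e} e∈E R<k (_ , k≤hi) ¬0N = ≮⇒≥ outside
        where
        outside : ¬ lo π e < R
        outside lo<R with lo π e ≟ 0 | aw
        ... | no lo≢0 | _ , aw∈E , lo-aw , hi-aw =
          planar⇒¬interleaved {π} planar aw∈E e∈E (subst (_< lo π e) (sym lo-aw) (n≢0⇒n>0 lo≢0))
            (subst (lo π e <_) (sym hi-aw) lo<R) (subst (_< hi π e) (sym hi-aw) (<-≤-trans R<k k≤hi))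
        ... | yes lo≡0 | _ with first-edge⇒adj {π} a-at-0 e∈E lo≡0
        ...   | x , a-x , x-at-hi =
          <⇒≱ (<-≤-trans R<k k≤hi) (subst (_≤ R) x-at-hi (w-max (a-x , ≤∧≢⇒< (pos≤N π x)
                λ x-at-N → ¬0N (lo≡0 , trans (sym x-at-hi) x-at-N))))

      hi≤S : ∀ {e k} → e ∈ E → k ≤ S → Spans k (pos₁ π e) (pos₂ π e) → ¬ (lo π e ≡ 0 × hi π e ≡ N) →
             hi π e ≤ S
      hi≤S {e} e∈E k≤S (lo<k , _) ¬0N = ≮⇒≥ outside
        where
        outside : ¬ S < hi π e
        outside S<hi with hi π e ≟ N | bz
        ... | no hi≢N | _ , bz∈E , lo-bz , hi-bz =
          planar⇒¬interleaved {π} planar e∈E bz∈E (subst (lo π e <_) (sym lo-bz) (<-≤-trans lo<k k≤S))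
            (subst (_< hi π e) (sym lo-bz) S<hi) (subst (hi π e <_) (sym hi-bz) (≤∧≢⇒< (hi≤N π e) hi≢N))
        ... | yes hi≡N | _ with last-edge⇒adj {π} b-at-N e∈E hi≡N
        ...   | x , b-x , x-at-lo =
          <⇒≱ (<-≤-trans lo<k k≤S) (subst (S ≤_) x-at-lo (z-min (b-x , n≢0⇒n>0
                λ x-at-0 → ¬0N (trans (sym x-at-lo) x-at-0 , hi≡N))))

      Reached : Vertex → Set
      Reached = Star (Adj (Without a b)) w

      Covered : ℕ → Vertex → Set
      Covered m x = ∃ λ e → e ∈ E × lo π e < pos π x × pos π x < hi π e × hi π e ≤ m

      Explored : ℕ → Set
      Explored m = (∃ λ x → pos π x ≡ m × Reached x)
                 × (∀ x → R ≤ pos π x → pos π x ≤ m → Reached x ⊎ Covered m x)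

      NoCleanCut : Set
      NoCleanCut = ∀ {k} → R < k → k ≤ S → ¬ CleanCut π k

      -- The cut after m is spanned by an edge other than ab; by planarity its left end is reached rather
      -- than covered, so the frontier moves on to its right end.
      explore-step : NoCleanCut → ∀ {m} → R ≤ m → m < S → Explored m →
                     ∃ λ m′ → m < m′ × m′ ≤ S × Explored m′
      explore-step no-clean {m} R≤m m<S (_ , explored) with ¬clean-cut⇒spanning-edge {π} (no-clean (s≤s R≤m) m<S)
      ... | e , e∈E , spans , ¬0N with endpoints π e
      ...   | xl , xh , e-lh , xl-at-lo , xh-at-hi =
        hi π e , proj₂ spans , hi≤S e∈E m<S spans ¬0N , (xh , xh-at-hi , xh-reached) , explored′
        where
        R≤xl : R ≤ pos π xl
        R≤xl = subst (R ≤_) (sym xl-at-lo) (R≤lo e∈E (s≤s R≤m) spans ¬0N)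
        xl≤m : pos π xl ≤ m
        xl≤m = subst (_≤ m) (sym xl-at-lo) (s≤s⁻¹ (proj₁ spans))
        xl-reached : Reached xl
        xl-reached with explored xl R≤xl xl≤m
        ... | inj₁ reached = reached
        ... | inj₂ (e′ , e′∈E , lo′<xl , xl<hi′ , hi′≤m) = ⊥-elim (planar⇒¬interleaved {π} planar e′∈E e∈E
                (subst (lo π e′ <_) xl-at-lo lo′<xl) (subst (_< hi π e′) xl-at-lo xl<hi′)
                (<-≤-trans (s≤s hi′≤m) (proj₂ spans)))
        xl≢a,b : ∀ {e′} → Joins e′ xl xh → ¬ Joins e′ a b
        xl≢a,b e′-lh e′-ab with joins-endpoint e′-lh e′-ab
        ... | inj₁ xl≡a = <⇒≱ 0<R (subst (R ≤_) (trans (cong (pos π) xl≡a) a-at-0) R≤xl)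
        ... | inj₂ xl≡b = <⇒≱ (<-≤-trans m<S (pos≤N π z)) (subst (_≤ m) (trans (cong (pos π) xl≡b) b-at-N) xl≤m)
        xh-reached : Reached xh
        xh-reached = xl-reached ◅◅ (adj-without (edge⇒adj e∈E e-lh) xl≢a,b ◅ ε)
        explored′ : ∀ x → R ≤ pos π x → pos π x ≤ hi π e → Reached x ⊎ Covered (hi π e) x
        explored′ x R≤x x≤hi with pos π x ≤? m | m≤n⇒m<n∨m≡n x≤hi
        ... | yes x≤m | _ = Data.Sum.map₂ (λ (e′ , e′∈E , p , q , hi′≤m) → e′ , e′∈E , p , q , ≤-trans hi′≤m m≤hi)
                                          (explored x R≤x x≤m)
          where
          m≤hi : m ≤ hi π e
          m≤hi = <⇒≤ (proj₂ spans)
        ... | no _ | inj₂ x-at-hi = inj₁ (subst Reached (pos-injective π (trans xh-at-hi (sym x-at-hi))) xh-reached)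
        ... | no x≰m | inj₁ x<hi = inj₂ (e , e∈E , <-≤-trans (proj₁ spans) (≰⇒> x≰m) , x<hi , ≤-refl)

      explore : NoCleanCut → ∀ fuel {m} → S ∸ m ≤ fuel → R ≤ m → m ≤ S → Explored m → Reached z
      explore no-clean fuel {m} S∸m≤fuel R≤m m≤S explored =
        [ continue fuel S∸m≤fuel , finish ]′ (m≤n⇒m<n∨m≡n m≤S)
        where
        finish : m ≡ S → Reached z
        finish m≡S = let (x , x-at-m , x-reached) = proj₁ explored in
                     subst Reached (pos-injective π (trans x-at-m m≡S)) x-reached
        continue : ∀ fuel → S ∸ m ≤ fuel → m < S → Reached z
        continue zero S∸m≤0 m<S = ⊥-elim (<⇒≱ (m<n⇒0<n∸m m<S) S∸m≤0)
        continue (suc fuel′) S∸m≤1+fuel′ m<S =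
          let (m′ , m<m′ , m′≤S , explored′) = explore-step no-clean R≤m m<S explored in
          explore no-clean fuel′ (s≤s⁻¹ (<-≤-trans (∸-monoʳ-< m<m′ m′≤S) S∸m≤1+fuel′))
                  (≤-trans R≤m (<⇒≤ m<m′)) m′≤S explored′

      detour : Reached z → Star (Adj (Without a b)) a b
      detour w⇝z = adj-without a-w (λ e-aw e-ab → <⇒≢ w<N (trans (cong (pos π) (joins-injective e-aw e-ab)) b-at-N))
                   ◅ w⇝z ◅◅ adj-without (adj-sym b-z) (λ e-zb e-ab → <⇒≢ 0<z
                          (sym (trans (cong (pos π) (joins-injective (joins-sym e-zb) (joins-sym e-ab))) a-at-0))) ◅ ε

      contradiction : ⊥
      contradiction with <-cmp R S | aw | bz
      ... | tri> _ _ S<R | _ , aw∈E , lo-aw , hi-aw | _ , bz∈E , lo-bz , hi-bz =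
        planar⇒¬interleaved {π} planar aw∈E bz∈E (subst₂ _<_ (sym lo-aw) (sym lo-bz) 0<z)
          (subst₂ _<_ (sym lo-bz) (sym hi-aw) S<R) (subst₂ _<_ (sym hi-aw) (sym hi-bz) w<N)
      ... | tri≈ _ R≡S _ | _ | _ = no-detour a-b (detour (subst Reached (pos-injective π R≡S) ε))
      ... | tri< R<S _ _ | _ | _ with search-interval (clean-cut? π) R S
      ...   | inj₂ no-clean = no-detour a-b (detour (explore no-clean (S ∸ R) ≤-refl ≤-refl (<⇒≤ R<S) explored-R))
        where
        explored-R : Explored R
        explored-R = (w , refl , ε) , λ x R≤x x≤R → inj₁ (subst Reached (pos-injective π (≤-antisym R≤x x≤R)) ε)
      ...   | inj₁ (suc j , R<1+j , 1+j≤S , clean) with j <? N ∸ j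
      ...     | yes j<N∸j = block-swap-contradiction {π} j (N ∸ j) max a-at-0 b-at-N a-b a-w 0<R (s≤s⁻¹ R<1+j)
                              (m+[n∸m]≡n (<⇒≤ (≤-trans 1+j≤S (<⇒≤ S<N)))) j<N∸j clean
      ...     | no j≮N∸j = block-swap-contradiction {reflect π} (N ∸ suc j) (suc j) (reflect-planar-max {π} max)
                             (trans (pos-reflect π b) (trans (cong (N ∸_) b-at-N) (n∸n≡0 N)))
                             (trans (pos-reflect π a) (cong (N ∸_) a-at-0))
                             (adj-sym a-b) b-z
                             (subst (0 <_) (sym (pos-reflect π z)) (m<n⇒0<n∸m S<N))
                             (subst (_≤ N ∸ suc j) (sym (pos-reflect π z)) (∸-monoʳ-≤ N 1+j≤S))
                             (m∸n+n≡m 1+j≤N)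
                             (s≤s (≤-trans (∸-monoʳ-≤ N (n≤1+n j)) (≮⇒≥ j≮N∸j)))
                             (subst (CleanCut (reflect π)) (+-∸-assoc 1 1+j≤N) (clean-cut-reflect {π} clean))
        where
        1+j≤N : suc j ≤ N
        1+j≤N = ≤-trans 1+j≤S (<⇒≤ S<N)

    ends-adjacent⇒leaf : Leaf E a ⊎ Leaf E b
    ends-adjacent⇒leaf with degree E a ≟ 1 | degree E b ≟ 1
    ... | yes leaf-a | _ = inj₁ leaf-a
    ... | no _ | yes leaf-b = inj₂ leaf-b
    ... | no ¬leaf-a | no ¬leaf-b
      with other-neighbour simple a-b ¬leaf-a | other-neighbour simple (adj-sym a-b) ¬leaf-b
    ...   | w₀ , a-w₀ , w₀≢b | z₀ , b-z₀ , z₀≢a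
      with maximiser (λ x → adj? a x ×-dec (pos π x <? N)) (pos π) (a-w₀ , ≤∧≢⇒< (pos≤N π w₀) (w₀≢b ∘ at-N))
         | minimiser (λ x → adj? b x ×-dec (0 <? pos π x)) (pos π) (b-z₀ , n≢0⇒n>0 (z₀≢a ∘ at-0))
    ...     | w , (a-w , w<N) , w-max | z , (b-z , 0<z) , z-min =
      ⊥-elim (Innermost.contradiction a-w w<N w-max b-z 0<z z-min)

  first⇒leaf-or-next-to-leaf : ∀ {ρ v} → 0 < N → PlanarMax ρ → pos ρ v ≡ 0 →
                               Leaf E v ⊎ (¬ Leaf E v × ∃[ u ] (Adj E v u × Leaf E u))
  first⇒leaf-or-next-to-leaf {ρ} {v} 0<N max v-at-0 =
    let (u , v-u , u-at-N) = first⇒neighbour-last {ρ} {v} max v-at-0 0<N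
    in  [ inj₁ , next-to-leaf v-u ]′ (EndToEnd.ends-adjacent⇒leaf {ρ} {v} {u} max v-at-0 u-at-N v-u)
    where
    next-to-leaf : ∀ {u} → Adj E v u → Leaf E u → Leaf E v ⊎ (¬ Leaf E v × ∃[ u ] (Adj E v u × Leaf E u))
    next-to-leaf {u} v-u leaf-u with degree E v ≟ 1
    ... | yes leaf-v = inj₁ leaf-v
    ... | no ¬leaf-v = inj₂ (¬leaf-v , u , v-u , leaf-u)

lemma2 : (n : ℕ) → 2 ≤ n → (E : Edges n) → IsTree n E →
    (v : Fin n) → InVStar E v →
    Leaf E v ⊎ (¬ Leaf E v × ∃[ u ] (Adj E v u × Leaf E u))
lemma2 .(suc N) (s≤s {n = N} 0<N) E tree v v∈V* =
  let (π , projective , max) = InVStar⇒projective-planar-max {v} v∈V*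
  in  [ first⇒leaf-or-next-to-leaf {π} 0<N max
      , first⇒leaf-or-next-to-leaf {reflect π} 0<N (reflect-planar-max {π} max) ∘ last⇒first-in-reflect {π}
      ]′ (projective-max⇒root-at-end {π} {v} projective max)
  where
  open Arrangements E
  open InTree E tree
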